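{- Let $A_1,\dots,A_m$ be chosen uniformly and independently from $\mathcal{K}=\binom{[n]}{k}$, $N=[m]$, and for $S\subseteq N$ let $A_S$ denote the multiset $\{A_i:i\in S\}$; let $\Delta$ be the maximum degree of the multiset $A_N$. Let $\alpha$ be a positive integer and $C$ a nonnegative integer, $s\in[m]$ and $t=m-s$. Suppose $S\in\binom{N}{s}$ and $\mathcal{D}$ is an $s$-multisubset of $\mathcal{K}$ with maximum degree at most $C$. If $\Pr(B(t,k/n)\ge\alpha-C)=\rho/n$, then $$\big|\Pr(\Delta\le\alpha\mid A_S=\mathcal{D})-\Pr(\Delta\le\alpha)\big|\le sk\rho/n+n(sk/n)^{C+1}.$$
   Context: $B(t,k/n)$ denotes a random variable with the binomial distribution $\mathrm{Bin}(t,k/n)$. The degree of a vertex $v$ in a multiset of sets is the number of members (with multiplicity) containing $v$. -}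

module Defs where

open import Data.Nat as ℕ using (ℕ; zero; suc; _≤_; _+_; _*_; _∸_)
open import Data.Nat.Combinatorics using (_C_)
open import Data.Integer using (+_)
open import Data.Rational as ℚ using (ℚ; 0ℚ; 1ℚ; _/_)
open import Data.Bool using (Bool; true; false)
import Data.Bool as Bool
open import Data.Fin using (Fin)
import Data.Fin.Properties as FinP
open import Data.Fin.Subset using (Subset; inside; outside; ∣_∣)
open import Data.Fin.Subset.Properties using (_∈?_)
open import Data.Vec as Vec using (Vec; []; _∷_; toList)
import Data.Vec.Properties as VecP
open import Data.List as List using (List; []; _∷_; filter; length; map; concatMap; _++_)
open import Data.Product using (_×_; _,_)
open import Relation.Nullary using (Dec; yes; no; ¬_)
open import Relation.Nullary.Decidable using (_×-dec_)
open import Relation.Binary.PropositionalEquality using (_≡_; refl; cong)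
import Data.Nat.Properties as ℕP

allSubsets : (n : ℕ) → List (Subset n)
allSubsets zero    = [] ∷ []
allSubsets (suc n) = map (outside ∷_) (allSubsets n) ++ map (inside ∷_) (allSubsets n)

kSets : (n k : ℕ) → List (Subset n)
kSets n k = filter (λ A → ∣ A ∣ ℕP.≟ k) (allSubsets n)

seqs : {X : Set} (m : ℕ) → List X → List (Vec X m)
seqs zero    xs = [] ∷ []
seqs (suc m) xs = concatMap (λ x → map (x ∷_) (seqs m xs)) xs

-- Multisets of sets (represented as lists)

degree : {n : ℕ} → Fin n → List (Subset n) → ℕ
degree v M = length (filter (v ∈?_) M)

MaxDegreeAtMost : {n : ℕ} → ℕ → List (Subset n) → Set
MaxDegreeAtMost d M = ∀ v → degree v M ≤ d

maxDegreeAtMost? : {n : ℕ} (d : ℕ) (M : List (Subset n)) → Dec (MaxDegreeAtMost d M)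
maxDegreeAtMost? d M = FinP.all? (λ v → degree v M ℕ.≤? d)

_≟ˢ_ : {n : ℕ} (A B : Subset n) → Dec (A ≡ B)
_≟ˢ_ = VecP.≡-dec Bool._≟_

mult : {n : ℕ} → Subset n → List (Subset n) → ℕ
mult A M = length (filter (A ≟ˢ_) M)

SameMultiset : {n : ℕ} → List (Subset n) → List (Subset n) → Set
SameMultiset M D = ∀ A → mult A M ≡ mult A D

allSubsets? : (n : ℕ) (P : Subset n → Set) → (∀ A → Dec (P A)) → Dec (∀ A → P A)
allSubsets? zero P P? with P? []
... | yes p = yes λ { [] → p }
... | no ¬p = no λ f → ¬p (f [])
allSubsets? (suc n) P P?
  with allSubsets? n (λ A → P (outside ∷ A)) (λ A → P? (outside ∷ A))
     | allSubsets? n (λ A → P (inside ∷ A)) (λ A → P? (inside ∷ A))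
... | yes f | yes g = yes λ { (false ∷ A) → f A ; (true ∷ A) → g A }
... | no ¬f | _     = no λ h → ¬f (λ A → h (outside ∷ A))
... | yes _ | no ¬g = no λ h → ¬g (λ A → h (inside ∷ A))

sameMultiset? : {n : ℕ} (M D : List (Subset n)) → Dec (SameMultiset M D)
sameMultiset? {n} M D = allSubsets? n _ (λ A → mult A M ℕP.≟ mult A D)

restrict : {X : Set} {m : ℕ} → Subset m → Vec X m → List X
restrict []           []       = []
restrict (true  ∷ S) (x ∷ xs) = x ∷ restrict S xs
restrict (false ∷ S) (x ∷ xs) = restrict S xs

-- a / b as a rational (convention: 0 if b = 0; never used with b = 0 here)
ratio : ℕ → ℕ → ℚ
ratio a zero    = 0ℚ
ratio a (suc b) = (+ a) / suc b

fromℕ : ℕ → ℚ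
fromℕ a = ratio a 1

pow : ℚ → ℕ → ℚ
pow q zero    = 1ℚ
pow q (suc e) = q ℚ.* pow q e

-- Probability space: A_1,…,A_m i.i.d. uniform on ([n] choose k)

Ω : (n k m : ℕ) → List (Vec (Subset n) m)
Ω n k m = seqs m (kSets n k)

PrΔ≤ : (n k m α : ℕ) → ℚ
PrΔ≤ n k m α =
  ratio (length (filter (λ ω → maxDegreeAtMost? α (toList ω)) (Ω n k m)))
        (length (Ω n k m))

PrΔ≤∣ : (n k m α : ℕ) → Subset m → List (Subset n) → ℚ
PrΔ≤∣ n k m α S D =
  ratio (length (filter (λ ω → sameMultiset? (restrict S ω) D ×-dec maxDegreeAtMost? α (toList ω)) (Ω n k m)))
        (length (filter (λ ω → sameMultiset? (restrict S ω) D) (Ω n k m)))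

binomPMF : ℕ → ℚ → ℕ → ℚ
binomPMF t p i = fromℕ (t C i) ℚ.* pow p i ℚ.* pow (1ℚ ℚ.- p) (t ∸ i)

binomTail : (t : ℕ) (p : ℚ) (α C : ℕ) → ℚ
binomTail t p α C =
  List.foldr ℚ._+_ 0ℚ
    (map (binomPMF t p) (filter (λ i → α ℕP.≤? i + C) (List.upTo (suc t))))

module Submission where

-- Everything is finite, so we argue by counting.  Let K = ([n] choose k),
-- M = |K|, and split a sample ω ∈ K^m into its S-part u ∈ K^s and the rest
-- w ∈ K^t.  Let completions(u) = #{w : deg_u(v) + deg_w(v) ≤ α for all v} and
-- good = #{w : Δ(w) ≤ α}.  Then Pr(Δ ≤ α | A_S = 𝒟) = completions(𝒟) / M^t
-- and Pr(Δ ≤ α) = Σ_u completions(u) / M^(s+t).  Always completions(u) ≤ good.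
-- Conversely, if Δ(u) ≤ C then a w counted by good but not by completions(u)
-- has deg_w(v) ≥ α - C at a vertex v covered by u, so
-- good ≤ completions(u) + s k T  with  T = #{w : deg_w(v) ≥ α - C}
-- = M^t Pr(B(t,k/n) ≥ α - C), as every vertex lies in a k/n fraction of K.
-- The u with a vertex of degree > C ("overloaded" vertices) number at most
-- n (s k/n)^(C+1) M^s, by a union bound over vertices.  Hence
-- |M^s completions(𝒟) - Σ_u completions(u)| ≤ #overloaded · M^t + M^s s k T,
-- and dividing by M^(s+t) gives the bound.

open import Data.Nat as ℕ using (ℕ)
open import Data.List using (List)
import Data.List.Relation.Unary.All
open import Data.Rational using (ℚ)
import Data.Fin.Subset
open import Relation.Nullary using (Dec)
open import Relation.Binary.PropositionalEquality using (_≡_)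
open import Defs using (ratio)

module Sums where

  open import Data.Nat using (ℕ; zero; suc; _+_; _*_; _≤_; _<_; _^_; _≟_; z≤n; s≤s)
  open import Data.Nat.Properties
  open import Data.Empty using (⊥-elim)
  open import Data.List using (List; []; _∷_; _++_; map; concatMap; filter; length; upTo; applyUpTo)
  open import Data.List.Membership.Propositional using (_∈_)
  open import Data.List.Relation.Unary.Any using (here; there)
  open import Data.List.Relation.Unary.All using (All; []; _∷_)
  open import Data.Fin using (Fin; zero; suc)
  open import Data.Vec using (Vec; []; _∷_; toList)
  open import Relation.Nullary using (Dec; yes; no; ¬_; _×-dec_)
  open import Relation.Binary.PropositionalEquality
  open import Defs using (seqs)

  Σ : {X : Set} → List X → (X → ℕ) → ℕ
  Σ [] f = 0
  Σ (x ∷ xs) f = f x + Σ xs f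

  ⟦_⟧ : {P : Set} → Dec P → ℕ
  ⟦ yes _ ⟧ = 1
  ⟦ no _ ⟧ = 0

  ⟦⟧≤1 : {P : Set} (d : Dec P) → ⟦ d ⟧ ≤ 1
  ⟦⟧≤1 (yes _) = s≤s z≤n
  ⟦⟧≤1 (no _) = z≤n

  ⟦yes⟧ : {P : Set} (d : Dec P) → P → ⟦ d ⟧ ≡ 1
  ⟦yes⟧ (yes _) p = refl
  ⟦yes⟧ (no ¬p) p = ⊥-elim (¬p p)

  ⟦no⟧ : {P : Set} (d : Dec P) → ¬ P → ⟦ d ⟧ ≡ 0
  ⟦no⟧ (yes p) ¬p = ⊥-elim (¬p p)
  ⟦no⟧ (no _) _ = refl

  ⟦⟧-mono : {P Q : Set} (dP : Dec P) (dQ : Dec Q) → (P → Q) → ⟦ dP ⟧ ≤ ⟦ dQ ⟧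
  ⟦⟧-mono (yes p) dQ f = ≤-reflexive (sym (⟦yes⟧ dQ (f p)))
  ⟦⟧-mono (no _) dQ f = z≤n

  ⟦⟧-iff : {P Q : Set} (dP : Dec P) (dQ : Dec Q) → (P → Q) → (Q → P) → ⟦ dP ⟧ ≡ ⟦ dQ ⟧
  ⟦⟧-iff dP dQ f g = ≤-antisym (⟦⟧-mono dP dQ f) (⟦⟧-mono dQ dP g)

  ⟦×⟧ : {P Q : Set} (p : Dec P) (q : Dec Q) → ⟦ p ×-dec q ⟧ ≡ ⟦ p ⟧ * ⟦ q ⟧
  ⟦×⟧ (yes _) (yes _) = refl
  ⟦×⟧ (yes _) (no _) = refl
  ⟦×⟧ (no _) _ = refl

  length-filter : {X : Set} {P : X → Set} (P? : ∀ x → Dec (P x)) (xs : List X) →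
    length (filter P? xs) ≡ Σ xs (λ x → ⟦ P? x ⟧)
  length-filter P? [] = refl
  length-filter P? (x ∷ xs) with P? x
  ... | yes _ = cong suc (length-filter P? xs)
  ... | no _ = length-filter P? xs

  Σ-filter : {X : Set} {Q : X → Set} (Q? : ∀ x → Dec (Q x)) (xs : List X) (g : X → ℕ) →
    Σ (filter Q? xs) g ≡ Σ xs (λ x → ⟦ Q? x ⟧ * g x)
  Σ-filter Q? [] g = refl
  Σ-filter Q? (x ∷ xs) g with Q? x
  ... | yes _ = cong₂ _+_ (sym (+-identityʳ (g x))) (Σ-filter Q? xs g)
  ... | no _ = Σ-filter Q? xs g

  Σ-cong : {X : Set} (xs : List X) {f g : X → ℕ} → (∀ x → f x ≡ g x) → Σ xs f ≡ Σ xs g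
  Σ-cong [] e = refl
  Σ-cong (x ∷ xs) e = cong₂ _+_ (e x) (Σ-cong xs e)

  Σ-mono : {X : Set} (xs : List X) {f g : X → ℕ} → (∀ x → f x ≤ g x) → Σ xs f ≤ Σ xs g
  Σ-mono [] e = z≤n
  Σ-mono (x ∷ xs) e = +-mono-≤ (e x) (Σ-mono xs e)

  Σ-mono∈ : {X : Set} (xs : List X) {f g : X → ℕ} → (∀ x → x ∈ xs → f x ≤ g x) → Σ xs f ≤ Σ xs g
  Σ-mono∈ [] e = z≤n
  Σ-mono∈ (x ∷ xs) e = +-mono-≤ (e x (here refl)) (Σ-mono∈ xs (λ y y∈ → e y (there y∈)))

  Σ-≥∈ : {X : Set} (xs : List X) (f : X → ℕ) {x : X} → x ∈ xs → f x ≤ Σ xs f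
  Σ-≥∈ (y ∷ xs) f (here refl) = m≤m+n (f y) (Σ xs f)
  Σ-≥∈ (y ∷ xs) f (there p) = ≤-trans (Σ-≥∈ xs f p) (m≤n+m (Σ xs f) (f y))

  Σ-++ : {X : Set} (xs ys : List X) (f : X → ℕ) → Σ (xs ++ ys) f ≡ Σ xs f + Σ ys f
  Σ-++ [] ys f = refl
  Σ-++ (x ∷ xs) ys f = trans (cong (f x +_) (Σ-++ xs ys f)) (sym (+-assoc (f x) _ _))

  Σ-map : {X Y : Set} (h : X → Y) (xs : List X) (f : Y → ℕ) → Σ (map h xs) f ≡ Σ xs (λ x → f (h x))
  Σ-map h [] f = refl
  Σ-map h (x ∷ xs) f = cong (f (h x) +_) (Σ-map h xs f)

  Σ-concatMap : {X Y : Set} (h : X → List Y) (xs : List X) (f : Y → ℕ) →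
    Σ (concatMap h xs) f ≡ Σ xs (λ x → Σ (h x) f)
  Σ-concatMap h [] f = refl
  Σ-concatMap h (x ∷ xs) f =
    trans (Σ-++ (h x) (concatMap h xs) f) (cong (Σ (h x) f +_) (Σ-concatMap h xs f))

  Σ-+ : {X : Set} (xs : List X) (f g : X → ℕ) → Σ xs (λ x → f x + g x) ≡ Σ xs f + Σ xs g
  Σ-+ [] f g = refl
  Σ-+ (x ∷ xs) f g =
    trans (cong (f x + g x +_) (Σ-+ xs f g)) (+-comm-middle (f x) (g x) (Σ xs f) (Σ xs g))
    where
    +-comm-middle : ∀ a b c d → (a + b) + (c + d) ≡ (a + c) + (b + d)
    +-comm-middle a b c d = begin
      (a + b) + (c + d) ≡⟨ +-assoc a b (c + d) ⟩
      a + (b + (c + d)) ≡⟨ cong (a +_) (sym (+-assoc b c d)) ⟩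
      a + ((b + c) + d) ≡⟨ cong (λ z → a + (z + d)) (+-comm b c) ⟩
      a + ((c + b) + d) ≡⟨ cong (a +_) (+-assoc c b d) ⟩
      a + (c + (b + d)) ≡⟨ sym (+-assoc a c (b + d)) ⟩
      (a + c) + (b + d) ∎
      where open ≡-Reasoning

  Σ-*ˡ : {X : Set} (c : ℕ) (xs : List X) (f : X → ℕ) → Σ xs (λ x → c * f x) ≡ c * Σ xs f
  Σ-*ˡ c [] f = sym (*-zeroʳ c)
  Σ-*ˡ c (x ∷ xs) f =
    trans (cong (c * f x +_) (Σ-*ˡ c xs f)) (sym (*-distribˡ-+ c (f x) (Σ xs f)))

  Σ-*ʳ : {X : Set} (c : ℕ) (xs : List X) (f : X → ℕ) → Σ xs (λ x → f x * c) ≡ Σ xs f * c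
  Σ-*ʳ c xs f = trans (Σ-cong xs (λ x → *-comm (f x) c)) (trans (Σ-*ˡ c xs f) (*-comm c (Σ xs f)))

  Σ-const : {X : Set} (xs : List X) (c : ℕ) → Σ xs (λ _ → c) ≡ length xs * c
  Σ-const [] c = refl
  Σ-const (x ∷ xs) c = cong (c +_) (Σ-const xs c)

  Σ-zero : {X : Set} (xs : List X) {f : X → ℕ} → (∀ x → f x ≡ 0) → Σ xs f ≡ 0
  Σ-zero xs e = trans (Σ-cong xs e) (trans (Σ-const xs 0) (*-zeroʳ (length xs)))

  length≡Σ1 : {X : Set} (xs : List X) → length xs ≡ Σ xs (λ _ → 1)
  length≡Σ1 xs = trans (sym (*-identityʳ (length xs))) (sym (Σ-const xs 1))

  Σ-swap : {X Y : Set} (xs : List X) (ys : List Y) (f : X → Y → ℕ) →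
    Σ xs (λ x → Σ ys (λ y → f x y)) ≡ Σ ys (λ y → Σ xs (λ x → f x y))
  Σ-swap [] ys f = sym (Σ-zero ys (λ _ → refl))
  Σ-swap (x ∷ xs) ys f = trans (cong (Σ ys (f x) +_) (Σ-swap xs ys f))
    (sym (Σ-+ ys (f x) (λ y → Σ xs (λ x' → f x' y))))

  Σ< : ℕ → (ℕ → ℕ) → ℕ
  Σ< zero g = 0
  Σ< (suc m) g = g 0 + Σ< m (λ i → g (suc i))

  Σ<-cong : ∀ m {f g : ℕ → ℕ} → (∀ i → f i ≡ g i) → Σ< m f ≡ Σ< m g
  Σ<-cong zero e = refl
  Σ<-cong (suc m) e = cong₂ _+_ (e 0) (Σ<-cong m (λ i → e (suc i)))

  Σ<-pick : ∀ m d (g : ℕ → ℕ) → d < m → Σ< m (λ i → ⟦ d ≟ i ⟧ * g i) ≡ g d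
  Σ<-pick (suc m) zero g _ = begin
    ⟦ 0 ≟ 0 ⟧ * g 0 + Σ< m (λ i → ⟦ 0 ≟ suc i ⟧ * g (suc i))
      ≡⟨ cong₂ _+_ (cong (_* g 0) (⟦yes⟧ (0 ≟ 0) refl))
                   (Σ<-zero m (λ i → cong (_* g (suc i)) (⟦no⟧ (0 ≟ suc i) (λ ())))) ⟩
    1 * g 0 + 0 ≡⟨ trans (+-identityʳ _) (*-identityˡ (g 0)) ⟩
    g 0 ∎
    where
    open ≡-Reasoning
    Σ<-zero : ∀ m {f : ℕ → ℕ} → (∀ i → f i ≡ 0) → Σ< m f ≡ 0
    Σ<-zero zero e = refl
    Σ<-zero (suc m) e = cong₂ _+_ (e 0) (Σ<-zero m (λ i → e (suc i)))
  Σ<-pick (suc m) (suc d) g (s≤s d<m) =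
    trans (cong₂ _+_ (cong (_* g 0) (⟦no⟧ (suc d ≟ 0) (λ ())))
                     (Σ<-cong m (λ i → cong (_* g (suc i))
                       (⟦⟧-iff (suc d ≟ suc i) (d ≟ i) suc-injective (cong suc)))))
          (Σ<-pick m d (λ i → g (suc i)) d<m)

  Σ-applyUpTo : ∀ m (f h : ℕ → ℕ) → Σ (applyUpTo f m) h ≡ Σ< m (λ i → h (f i))
  Σ-applyUpTo zero f h = refl
  Σ-applyUpTo (suc m) f h = cong (h (f 0) +_) (Σ-applyUpTo m (λ i → f (suc i)) h)

  Σ-upTo-pick : ∀ t d (g : ℕ → ℕ) → d ≤ t → Σ (upTo (suc t)) (λ i → ⟦ d ≟ i ⟧ * g i) ≡ g d
  Σ-upTo-pick t d g d≤t = trans (Σ-applyUpTo (suc t) (λ i → i) _) (Σ<-pick (suc t) d g (s≤s d≤t))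

  ΣF : (n : ℕ) → (Fin n → ℕ) → ℕ
  ΣF zero f = 0
  ΣF (suc n) f = f zero + ΣF n (λ v → f (suc v))

  ΣF-cong : ∀ n {f g : Fin n → ℕ} → (∀ v → f v ≡ g v) → ΣF n f ≡ ΣF n g
  ΣF-cong zero e = refl
  ΣF-cong (suc n) e = cong₂ _+_ (e zero) (ΣF-cong n (λ v → e (suc v)))

  ΣF-mono : ∀ n {f g : Fin n → ℕ} → (∀ v → f v ≤ g v) → ΣF n f ≤ ΣF n g
  ΣF-mono zero e = z≤n
  ΣF-mono (suc n) e = +-mono-≤ (e zero) (ΣF-mono n (λ v → e (suc v)))

  ΣF-≥ : ∀ n (f : Fin n → ℕ) v → f v ≤ ΣF n f
  ΣF-≥ (suc n) f zero = m≤m+n _ _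
  ΣF-≥ (suc n) f (suc v) = ≤-trans (ΣF-≥ n (λ w → f (suc w)) v) (m≤n+m _ _)

  ΣF-const : ∀ n c → ΣF n (λ _ → c) ≡ n * c
  ΣF-const zero c = refl
  ΣF-const (suc n) c = cong (c +_) (ΣF-const n c)

  ΣF-*ʳ : ∀ n (f : Fin n → ℕ) c → ΣF n (λ v → f v * c) ≡ ΣF n f * c
  ΣF-*ʳ zero f c = refl
  ΣF-*ʳ (suc n) f c =
    trans (cong (f zero * c +_) (ΣF-*ʳ n (λ v → f (suc v)) c)) (sym (*-distribʳ-+ c (f zero) _))

  ΣF-swap : ∀ n {X : Set} (L : List X) (g : Fin n → X → ℕ) →
    ΣF n (λ v → Σ L (g v)) ≡ Σ L (λ x → ΣF n (λ v → g v x))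
  ΣF-swap zero L g = sym (Σ-zero L (λ _ → refl))
  ΣF-swap (suc n) L g = trans (cong (Σ L (g zero) +_) (ΣF-swap n L (λ v → g (suc v))))
    (sym (Σ-+ L (g zero) (λ x → ΣF n (λ v → g (suc v) x))))

  Σ-seqs : {X : Set} (m : ℕ) (K : List X) (f : Vec X (suc m) → ℕ) →
    Σ (seqs (suc m) K) f ≡ Σ K (λ x → Σ (seqs m K) (λ w → f (x ∷ w)))
  Σ-seqs m K f = trans (Σ-concatMap (λ x → map (x ∷_) (seqs m K)) K f)
    (Σ-cong K (λ x → Σ-map (x ∷_) (seqs m K) f))

  length-seqs : {X : Set} (m : ℕ) (K : List X) → length (seqs m K) ≡ length K ^ m
  length-seqs zero K = refl
  length-seqs (suc m) K = begin
    length (seqs (suc m) K) ≡⟨ length≡Σ1 (seqs (suc m) K) ⟩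
    Σ (seqs (suc m) K) (λ _ → 1) ≡⟨ Σ-seqs m K (λ _ → 1) ⟩
    Σ K (λ x → Σ (seqs m K) (λ _ → 1))
      ≡⟨ Σ-cong K (λ x → trans (sym (length≡Σ1 (seqs m K))) (length-seqs m K)) ⟩
    Σ K (λ x → length K ^ m) ≡⟨ Σ-const K _ ⟩
    length K * length K ^ m ∎
    where open ≡-Reasoning

  Σ-seqs-const : {X : Set} (m : ℕ) (K : List X) (c : ℕ) → Σ (seqs m K) (λ _ → c) ≡ length K ^ m * c
  Σ-seqs-const m K c = trans (Σ-const (seqs m K) c) (cong (_* c) (length-seqs m K))

  Σ-seqs-≥ : {X : Set} (K : List X) (m : ℕ) (f : Vec X m → ℕ) (u : Vec X m) →
    All (_∈ K) (toList u) → f u ≤ Σ (seqs m K) f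
  Σ-seqs-≥ K zero f [] _ = m≤m+n (f []) 0
  Σ-seqs-≥ K (suc m) f (x ∷ u) (x∈ ∷ us) = begin
    f (x ∷ u) ≤⟨ Σ-seqs-≥ K m (λ w → f (x ∷ w)) u us ⟩
    Σ (seqs m K) (λ w → f (x ∷ w)) ≤⟨ Σ-≥∈ K (λ y → Σ (seqs m K) (λ w → f (y ∷ w))) x∈ ⟩
    Σ K (λ y → Σ (seqs m K) (λ w → f (y ∷ w))) ≡⟨ sym (Σ-seqs m K f) ⟩
    Σ (seqs (suc m) K) f ∎
    where open ≤-Reasoning

  Σ-seqs-mono : {X : Set} (K : List X) (m : ℕ) (f g : Vec X m → ℕ) →
    (∀ u → All (_∈ K) (toList u) → f u ≤ g u) → Σ (seqs m K) f ≤ Σ (seqs m K) g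
  Σ-seqs-mono K zero f g h = +-monoˡ-≤ 0 (h [] [])
  Σ-seqs-mono K (suc m) f g h = begin
    Σ (seqs (suc m) K) f ≡⟨ Σ-seqs m K f ⟩
    Σ K (λ x → Σ (seqs m K) (λ w → f (x ∷ w)))
      ≤⟨ Σ-mono∈ K (λ x x∈ → Σ-seqs-mono K m _ _ (λ u us → h (x ∷ u) (x∈ ∷ us))) ⟩
    Σ K (λ x → Σ (seqs m K) (λ w → g (x ∷ w))) ≡⟨ sym (Σ-seqs m K g) ⟩
    Σ (seqs (suc m) K) g ∎
    where open ≤-Reasoning

module SplitAlongS where

  open import Data.Nat using (ℕ; suc; _+_; _∸_)
  open import Data.Nat.Properties
  open import Data.Bool using (true; false)
  open import Data.List using (List; []; _∷_)
  open import Data.Vec using (Vec; []; _∷_; toList)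
  open import Data.Fin.Subset using (Subset; ∣_∣)
  open import Relation.Binary.PropositionalEquality
  open import Defs using (seqs; restrict)
  open Sums

  restrictᶜ : {X : Set} {m : ℕ} → Subset m → Vec X m → List X
  restrictᶜ []          []       = []
  restrictᶜ (true  ∷ S) (x ∷ xs) = restrictᶜ S xs
  restrictᶜ (false ∷ S) (x ∷ xs) = x ∷ restrictᶜ S xs

  -- |S| and |N ∖ S|, by recursions matching restrict and restrictᶜ
  card cocard : {m : ℕ} → Subset m → ℕ
  card [] = 0
  card (true ∷ S) = suc (card S)
  card (false ∷ S) = card S
  cocard [] = 0
  cocard (true ∷ S) = cocard S
  cocard (false ∷ S) = suc (cocard S)

  card≡∣∣ : {m : ℕ} (S : Subset m) → card S ≡ ∣ S ∣
  card≡∣∣ [] = refl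
  card≡∣∣ (true ∷ S) = cong suc (card≡∣∣ S)
  card≡∣∣ (false ∷ S) = card≡∣∣ S

  card+cocard : {m : ℕ} (S : Subset m) → card S + cocard S ≡ m
  card+cocard [] = refl
  card+cocard (true ∷ S) = cong suc (card+cocard S)
  card+cocard (false ∷ S) = trans (+-suc (card S) (cocard S)) (cong suc (card+cocard S))

  cocard≡ : {m : ℕ} (S : Subset m) → cocard S ≡ m ∸ ∣ S ∣
  cocard≡ {m} S =
    trans (sym (m+n∸m≡n (card S) (cocard S))) (cong₂ _∸_ (card+cocard S) (card≡∣∣ S))

  Σ-split : {X : Set} {m : ℕ} (S : Subset m) (ω : Vec X m) (g : X → ℕ) →
    Σ (toList ω) g ≡ Σ (restrict S ω) g + Σ (restrictᶜ S ω) g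
  Σ-split [] [] g = refl
  Σ-split (true ∷ S) (x ∷ ω) g =
    trans (cong (g x +_) (Σ-split S ω g)) (sym (+-assoc (g x) _ _))
  Σ-split (false ∷ S) (x ∷ ω) g = begin
    g x + Σ (toList ω) g ≡⟨ cong (g x +_) (Σ-split S ω g) ⟩
    g x + (A + B)        ≡⟨ sym (+-assoc (g x) A B) ⟩
    (g x + A) + B        ≡⟨ cong (_+ B) (+-comm (g x) A) ⟩
    (A + g x) + B        ≡⟨ +-assoc A (g x) B ⟩
    A + (g x + B)        ∎
    where
    open ≡-Reasoning
    A = Σ (restrict S ω) g
    B = Σ (restrictᶜ S ω) g

  Σ-split-seqs : {X : Set} {m : ℕ} (S : Subset m) (K : List X) (h : List X → List X → ℕ) →
    Σ (seqs m K) (λ ω → h (restrict S ω) (restrictᶜ S ω)) ≡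
    Σ (seqs (card S) K) (λ u → Σ (seqs (cocard S) K) (λ w → h (toList u) (toList w)))
  Σ-split-seqs [] K h = cong (_+ 0) (sym (+-identityʳ (h [] [])))
  Σ-split-seqs {m = suc m} (true ∷ S) K h = begin
    Σ (seqs (suc m) K) (λ ω → h (restrict (true ∷ S) ω) (restrictᶜ (true ∷ S) ω))
      ≡⟨ Σ-seqs m K _ ⟩
    Σ K (λ x → Σ (seqs m K) (λ w → h (x ∷ restrict S w) (restrictᶜ S w)))
      ≡⟨ Σ-cong K (λ x → Σ-split-seqs S K (λ u w → h (x ∷ u) w)) ⟩
    Σ K (λ x → Σ (seqs (card S) K) (λ u → Σ (seqs (cocard S) K) (λ w → h (x ∷ toList u) (toList w))))
      ≡⟨ sym (Σ-seqs (card S) K _) ⟩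
    Σ (seqs (suc (card S)) K) (λ u → Σ (seqs (cocard S) K) (λ w → h (toList u) (toList w))) ∎
    where open ≡-Reasoning
  Σ-split-seqs {m = suc m} (false ∷ S) K h = begin
    Σ (seqs (suc m) K) (λ ω → h (restrict (false ∷ S) ω) (restrictᶜ (false ∷ S) ω))
      ≡⟨ Σ-seqs m K _ ⟩
    Σ K (λ x → Σ (seqs m K) (λ w → h (restrict S w) (x ∷ restrictᶜ S w)))
      ≡⟨ Σ-cong K (λ x → Σ-split-seqs S K (λ u w → h u (x ∷ w))) ⟩
    Σ K (λ x → Σ (seqs (card S) K) (λ u → Σ (seqs (cocard S) K) (λ w → h (toList u) (x ∷ toList w))))
      ≡⟨ Σ-swap K (seqs (card S) K) _ ⟩
    Σ (seqs (card S) K) (λ u → Σ K (λ x → Σ (seqs (cocard S) K) (λ w → h (toList u) (x ∷ toList w))))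
      ≡⟨ Σ-cong (seqs (card S) K) (λ u → sym (Σ-seqs (cocard S) K _)) ⟩
    Σ (seqs (card S) K) (λ u → Σ (seqs (suc (cocard S)) K) (λ w → h (toList u) (toList w))) ∎
    where open ≡-Reasoning

module Multisets where

  open import Data.Nat using (ℕ; zero; suc; _+_; _*_; _≟_)
  open import Data.Nat.Properties
  open import Data.Bool using (Bool; true; false)
  open import Data.List using (List; []; _∷_; map)
  open import Data.List.Membership.Propositional using (_∈_)
  open import Data.List.Membership.Propositional.Properties
    using (∈-map⁺; ∈-++⁺ˡ; ∈-++⁺ʳ; ∈-filter⁺; ∈-filter⁻)
  open import Data.List.Relation.Unary.Any using (here)
  open import Data.Vec using (_∷_; [])
  open import Data.Fin using (Fin; suc)
  open import Data.Fin.Subset using (Subset; ∣_∣; inside; outside)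
  open import Data.Fin.Subset.Properties using (_∈?_; drop-there)
  open import Data.Vec.Base using (there)
  open import Data.Product using (_,_; proj₁; proj₂; _×_)
  open import Relation.Nullary using (¬_)
  open import Relation.Binary.PropositionalEquality
  open import Defs
  open Sums

  deg : {n : ℕ} → List (Subset n) → Fin n → ℕ
  deg L v = Σ L (λ A → ⟦ v ∈? A ⟧)

  degree≡deg : {n : ℕ} (v : Fin n) (L : List (Subset n)) → degree v L ≡ deg L v
  degree≡deg v L = length-filter (v ∈?_) L

  ⟦suc∈⟧ : ∀ {n} (v : Fin n) b (A : Subset n) → ⟦ suc v ∈? (b ∷ A) ⟧ ≡ ⟦ v ∈? A ⟧
  ⟦suc∈⟧ v b A = ⟦⟧-iff (suc v ∈? (b ∷ A)) (v ∈? A) drop-there there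

  Σ-allSubsets : (n : ℕ) (f : Subset (suc n) → ℕ) →
    Σ (allSubsets (suc n)) f ≡
    Σ (allSubsets n) (λ A → f (outside ∷ A)) + Σ (allSubsets n) (λ A → f (inside ∷ A))
  Σ-allSubsets n f = trans (Σ-++ (map (outside ∷_) (allSubsets n)) _ f)
    (cong₂ _+_ (Σ-map (outside ∷_) (allSubsets n) f) (Σ-map (inside ∷_) (allSubsets n) f))

  private
    ∷-injective : {n : ℕ} {b c : Bool} {A B : Subset n} →
      _≡_ {A = Subset (suc n)} (b ∷ A) (c ∷ B) → b ≡ c × A ≡ B
    ∷-injective refl = refl , refl

  Σ-allSubsets-pick : (n : ℕ) (x : Subset n) (g : Subset n → ℕ) →
    Σ (allSubsets n) (λ A → ⟦ A ≟ˢ x ⟧ * g A) ≡ g x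
  Σ-allSubsets-pick zero [] g = trans (+-identityʳ _) (*-identityˡ (g []))
  Σ-allSubsets-pick (suc n) (b ∷ x) g = trans (Σ-allSubsets n _) (both b)
    where
    same : (c : Bool) → Σ (allSubsets n) (λ A → ⟦ (c ∷ A) ≟ˢ (c ∷ x) ⟧ * g (c ∷ A)) ≡ g (c ∷ x)
    same c = trans (Σ-cong (allSubsets n) (λ A → cong (_* g (c ∷ A))
                     (⟦⟧-iff ((c ∷ A) ≟ˢ (c ∷ x)) (A ≟ˢ x) (λ e → proj₂ (∷-injective e)) (cong (c ∷_)))))
                   (Σ-allSubsets-pick n x (λ A → g (c ∷ A)))
    other : (c b : Bool) → ¬ c ≡ b → Σ (allSubsets n) (λ A → ⟦ (c ∷ A) ≟ˢ (b ∷ x) ⟧ * g (c ∷ A)) ≡ 0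
    other c b c≢b = Σ-zero (allSubsets n) (λ A → cong (_* g (c ∷ A))
                      (⟦no⟧ ((c ∷ A) ≟ˢ (b ∷ x)) (λ e → c≢b (proj₁ (∷-injective e)))))
    both : (b : Bool) → Σ (allSubsets n) (λ A → ⟦ (outside ∷ A) ≟ˢ (b ∷ x) ⟧ * g (outside ∷ A)) +
                        Σ (allSubsets n) (λ A → ⟦ (inside ∷ A) ≟ˢ (b ∷ x) ⟧ * g (inside ∷ A)) ≡ g (b ∷ x)
    both false = trans (cong₂ _+_ (same false) (other true false (λ ()))) (+-identityʳ _)
    both true = cong₂ _+_ (other false true (λ ())) (same true)

  Σ-via-mult : {n : ℕ} (L : List (Subset n)) (g : Subset n → ℕ) →
    Σ L g ≡ Σ (allSubsets n) (λ A → mult A L * g A)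
  Σ-via-mult {n} [] g = sym (Σ-zero (allSubsets n) (λ _ → refl))
  Σ-via-mult {n} (x ∷ L) g = begin
    g x + Σ L g
      ≡⟨ cong₂ _+_ (sym (Σ-allSubsets-pick n x g)) (Σ-via-mult L g) ⟩
    Σ all (λ A → ⟦ A ≟ˢ x ⟧ * g A) + Σ all (λ A → mult A L * g A)
      ≡⟨ sym (Σ-+ all _ _) ⟩
    Σ all (λ A → ⟦ A ≟ˢ x ⟧ * g A + mult A L * g A)
      ≡⟨ Σ-cong all (λ A → sym (*-distribʳ-+ (g A) ⟦ A ≟ˢ x ⟧ (mult A L))) ⟩
    Σ all (λ A → (⟦ A ≟ˢ x ⟧ + mult A L) * g A)
      ≡⟨ Σ-cong all (λ A → cong (λ z → (⟦ A ≟ˢ x ⟧ + z) * g A) (length-filter (A ≟ˢ_) L)) ⟩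
    Σ all (λ A → (⟦ A ≟ˢ x ⟧ + Σ L (λ B → ⟦ A ≟ˢ B ⟧)) * g A)
      ≡⟨ Σ-cong all (λ A → cong (_* g A) (sym (length-filter (A ≟ˢ_) (x ∷ L)))) ⟩
    Σ all (λ A → mult A (x ∷ L) * g A) ∎
    where
    open ≡-Reasoning
    all = allSubsets n

  Σ-sameMultiset : {n : ℕ} (L D : List (Subset n)) → SameMultiset L D →
    (g : Subset n → ℕ) → Σ L g ≡ Σ D g
  Σ-sameMultiset {n} L D sm g = trans (Σ-via-mult L g)
    (trans (Σ-cong (allSubsets n) (λ A → cong (_* g A) (sm A))) (sym (Σ-via-mult D g)))

  ∈-allSubsets : (n : ℕ) (A : Subset n) → A ∈ allSubsets n
  ∈-allSubsets zero [] = here refl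
  ∈-allSubsets (suc n) (false ∷ A) = ∈-++⁺ˡ (∈-map⁺ (outside ∷_) (∈-allSubsets n A))
  ∈-allSubsets (suc n) (true ∷ A) =
    ∈-++⁺ʳ (map (outside ∷_) (allSubsets n)) (∈-map⁺ (inside ∷_) (∈-allSubsets n A))

  ∈-kSets : (n k : ℕ) (A : Subset n) → ∣ A ∣ ≡ k → A ∈ kSets n k
  ∈-kSets n k A e = ∈-filter⁺ (λ A → ∣ A ∣ ≟ k) (∈-allSubsets n A) e

  kSets-size : (n k : ℕ) (A : Subset n) → A ∈ kSets n k → ∣ A ∣ ≡ k
  kSets-size n k A A∈ = proj₂ (∈-filter⁻ (λ A → ∣ A ∣ ≟ k) {xs = allSubsets n} A∈)

-- Arithmetic of the fractions ratio a b = a/b (b ≥ 1): all probabilities here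
-- are such fractions, and every rational identity or inequality we need
-- reduces to one between natural numbers by cross-multiplication.
module Fractions where

  open import Data.Nat as ℕ using (ℕ; zero; suc; _^_)
  import Data.Nat.Properties as ℕP
  open import Data.Integer as ℤ using (+_; +≤+)
  import Data.Integer.Properties as ℤP
  open import Data.Rational as ℚ using (_+_; _-_; _*_; -_; _≤_; ∣_∣; toℚᵘ)
  open import Data.Rational.Properties
  open import Data.Rational.Unnormalised as U using (ℚᵘ; mkℚᵘ; *≡*; *≤*)
  import Data.Rational.Unnormalised.Properties as UP
  open import Data.Sum using (inj₁; inj₂)
  open import Relation.Binary.PropositionalEquality
  open import Defs using (ratio; pow)
  import Algebra.Properties.Group as GroupProperties

  1≤* : ∀ {x y} → 1 ℕ.≤ x → 1 ℕ.≤ y → 1 ℕ.≤ x ℕ.* y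
  1≤* {x} {y} p q = ℕP.*-mono-≤ {1} {x} {1} {y} p q

  1≤^ : ∀ {b} e → 1 ℕ.≤ b → 1 ℕ.≤ b ^ e
  1≤^ zero _ = ℕ.s≤s ℕ.z≤n
  1≤^ (suc e) b≥1 = 1≤* b≥1 (1≤^ e b≥1)

  private
    -- the unnormalised fraction a / (1 + d), which ratio a (suc d) normalises
    frac : ℕ → ℕ → ℚᵘ
    frac a d = mkℚᵘ (+ a) d

    toℚᵘ-ratio : (a d : ℕ) → toℚᵘ (ratio a (suc d)) U.≃ frac a d
    toℚᵘ-ratio a d = toℚᵘ-fromℚᵘ (frac a d)

    ratio-cong′ : ∀ a b c d → a ℕ.* suc d ≡ c ℕ.* suc b → ratio a (suc b) ≡ ratio c (suc d)
    ratio-cong′ a b c d e = fromℚᵘ-cong {frac a b} {frac c d}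
      (*≡* (trans (sym (ℤP.pos-* a (suc d))) (trans (cong +_ e) (ℤP.pos-* c (suc b)))))

    ratio-≤′ : ∀ a b c d → a ℕ.* suc d ℕ.≤ c ℕ.* suc b → ratio a (suc b) ≤ ratio c (suc d)
    ratio-≤′ a b c d le = toℚᵘ-cancel-≤
      (UP.≤-respˡ-≃ (UP.≃-sym (toℚᵘ-ratio a b)) (UP.≤-respʳ-≃ (UP.≃-sym (toℚᵘ-ratio c d))
        (*≤* (subst₂ ℤ._≤_ (ℤP.pos-* a (suc d)) (ℤP.pos-* c (suc b)) (+≤+ le)))))

    ratio-*′ : ∀ a b c d → ratio a (suc b) * ratio c (suc d) ≡ ratio (a ℕ.* c) (suc b ℕ.* suc d)
    ratio-*′ a b c d = toℚᵘ-injective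
      (UP.≃-trans (toℚᵘ-homo-* (ratio a (suc b)) (ratio c (suc d)))
      (UP.≃-trans (UP.*-cong (toℚᵘ-ratio a b) (toℚᵘ-ratio c d))
      (UP.≃-trans (UP.≃-reflexive (cong (λ z → mkℚᵘ z (d ℕ.+ b ℕ.* suc d)) (sym (ℤP.pos-* a c))))
      (UP.≃-sym (toℚᵘ-ratio (a ℕ.* c) (d ℕ.+ b ℕ.* suc d))))))

    ratio-+′ : ∀ a b c d →
      ratio a (suc b) + ratio c (suc d) ≡ ratio (a ℕ.* suc d ℕ.+ c ℕ.* suc b) (suc b ℕ.* suc d)
    ratio-+′ a b c d = toℚᵘ-injective
      (UP.≃-trans (toℚᵘ-homo-+ (ratio a (suc b)) (ratio c (suc d)))
      (UP.≃-trans (UP.+-cong (toℚᵘ-ratio a b) (toℚᵘ-ratio c d))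
      (UP.≃-trans (UP.≃-reflexive (cong (λ z → mkℚᵘ z (d ℕ.+ b ℕ.* suc d)) numerator))
      (UP.≃-sym (toℚᵘ-ratio (a ℕ.* suc d ℕ.+ c ℕ.* suc b) (d ℕ.+ b ℕ.* suc d))))))
      where
      numerator : (+ a ℤ.* + suc d) ℤ.+ (+ c ℤ.* + suc b) ≡ + (a ℕ.* suc d ℕ.+ c ℕ.* suc b)
      numerator = trans (cong₂ ℤ._+_ (sym (ℤP.pos-* a (suc d))) (sym (ℤP.pos-* c (suc b))))
                        (sym (ℤP.pos-+ (a ℕ.* suc d) (c ℕ.* suc b)))

  ratio-cong : ∀ a b c d → 1 ℕ.≤ b → 1 ℕ.≤ d → a ℕ.* d ≡ c ℕ.* b → ratio a b ≡ ratio c d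
  ratio-cong a (suc b) c (suc d) _ _ e = ratio-cong′ a b c d e

  ratio-≤ : ∀ a b c d → 1 ℕ.≤ b → 1 ℕ.≤ d → a ℕ.* d ℕ.≤ c ℕ.* b → ratio a b ≤ ratio c d
  ratio-≤ a (suc b) c (suc d) _ _ le = ratio-≤′ a b c d le

  ratio-* : ∀ {a b c d} → 1 ℕ.≤ b → 1 ℕ.≤ d → ratio a b * ratio c d ≡ ratio (a ℕ.* c) (b ℕ.* d)
  ratio-* {a} {suc b} {c} {suc d} _ _ = ratio-*′ a b c d

  ratio-+ : ∀ {a c D} → 1 ℕ.≤ D → ratio a D + ratio c D ≡ ratio (a ℕ.+ c) D
  ratio-+ {a} {c} {suc D} D≥1 = trans (ratio-+′ a D c D)
    (ratio-cong (a ℕ.* suc D ℕ.+ c ℕ.* suc D) (suc D ℕ.* suc D) (a ℕ.+ c) (suc D) (1≤* D≥1 D≥1) D≥1 cross)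
    where
    cross : (a ℕ.* suc D ℕ.+ c ℕ.* suc D) ℕ.* suc D ≡ (a ℕ.+ c) ℕ.* (suc D ℕ.* suc D)
    cross = trans (cong (ℕ._* suc D) (sym (ℕP.*-distribʳ-+ (suc D) a c)))
                  (ℕP.*-assoc (a ℕ.+ c) (suc D) (suc D))

  ratio-pow : ∀ {a b} e → 1 ℕ.≤ b → pow (ratio a b) e ≡ ratio (a ^ e) (b ^ e)
  ratio-pow zero b≥1 = refl
  ratio-pow {a} {b} (suc e) b≥1 =
    trans (cong (ratio a b *_) (ratio-pow e b≥1)) (ratio-* b≥1 (1≤^ e b≥1))

  ≤+⇒-≤ : ∀ x y z → x ≤ y + z → x - y ≤ z
  ≤+⇒-≤ x y z h = ≤-trans (+-monoˡ-≤ (- y) h) (≤-reflexive cancel)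
    where
    cancel : (y + z) - y ≡ z
    cancel = trans (cong (_- y) (+-comm y z))
      (trans (+-assoc z y (- y)) (trans (cong (λ w → z + w) (+-inverseʳ y)) (+-identityʳ z)))

  ∣-∣≤ : ∀ x y z → x ≤ y + z → y ≤ x + z → ∣ x - y ∣ ≤ z
  ∣-∣≤ x y z h₁ h₂ with ∣p∣≡p∨∣p∣≡-p (x - y)
  ... | inj₁ e = subst (_≤ z) (sym e) (≤+⇒-≤ x y z h₁)
  ... | inj₂ e = subst (_≤ z) (sym (trans e neg-sub)) (≤+⇒-≤ y x z h₂)
    where
    neg-sub : - (x - y) ≡ y - x
    neg-sub = trans (neg-distrib-+ x (- y))
      (trans (cong (λ w → - x + w) (GroupProperties.⁻¹-involutive +-0-group y)) (+-comm (- x) y))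

  ratio-∣-∣≤ : ∀ {A B E D} → 1 ℕ.≤ D → A ℕ.≤ B ℕ.+ E → B ℕ.≤ A ℕ.+ E →
    ∣ ratio A D - ratio B D ∣ ≤ ratio E D
  ratio-∣-∣≤ {A} {B} {E} {D} D≥1 h₁ h₂ = ∣-∣≤ (ratio A D) (ratio B D) (ratio E D)
    (subst (ratio A D ≤_) (sym (ratio-+ D≥1)) (ratio-≤ A D (B ℕ.+ E) D D≥1 D≥1 (ℕP.*-monoˡ-≤ D h₁)))
    (subst (ratio B D ≤_) (sym (ratio-+ D≥1)) (ratio-≤ B D (A ℕ.+ E) D D≥1 D≥1 (ℕP.*-monoˡ-≤ D h₂)))

-- Binomial coefficients, defined by Pascal's rule so that the counting
-- recursions below match them clause by clause.
module Binomial where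

  open import Data.Nat using (ℕ; zero; suc; _+_; _*_; _≤_; _<_; _^_; z≤n; s≤s)
  open import Data.Nat.Properties
  open import Data.Nat.Combinatorics using (_C_; nCk+nC[k+1]≡[n+1]C[k+1])
  open import Data.Nat.Tactic.RingSolver
  open import Relation.Binary.PropositionalEquality

  bin : ℕ → ℕ → ℕ
  bin _ zero = 1
  bin zero (suc k) = 0
  bin (suc n) (suc k) = bin n k + bin n (suc k)

  C≡bin : ∀ t i → t C i ≡ bin t i
  C≡bin t zero = refl
  C≡bin zero (suc i) = refl
  C≡bin (suc t) (suc i) =
    trans (sym (nCk+nC[k+1]≡[n+1]C[k+1] t i)) (cong₂ _+_ (C≡bin t i) (C≡bin t (suc i)))

  bin-0 : ∀ n k → n < k → bin n k ≡ 0
  bin-0 zero (suc k) _ = refl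
  bin-0 (suc n) (suc k) (s≤s n<k) =
    cong₂ _+_ (bin-0 n k n<k) (bin-0 n (suc k) (m<n⇒m<1+n n<k))

  bin≥1 : ∀ n k → k ≤ n → 1 ≤ bin n k
  bin≥1 n zero _ = s≤s z≤n
  bin≥1 (suc n) (suc k) (s≤s k≤n) = ≤-trans (bin≥1 n k k≤n) (m≤m+n _ _)

  bin-absorb : ∀ n k → suc k * bin (suc n) (suc k) ≡ suc n * bin n k
  bin-absorb zero zero = refl
  bin-absorb zero (suc k) = *-zeroʳ (suc (suc k))
  bin-absorb (suc n) zero = begin
    1 * (bin (suc n) 0 + bin (suc n) 1) ≡⟨ *-identityˡ _ ⟩
    1 + bin (suc n) 1                    ≡⟨ cong suc (trans (sym (*-identityˡ _)) (bin-absorb n 0)) ⟩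
    1 + (suc n * 1)                      ≡⟨ cong suc (*-identityʳ (suc n)) ⟩
    suc (suc n)                          ≡⟨ sym (*-identityʳ (suc (suc n))) ⟩
    suc (suc n) * 1                      ∎
    where open ≡-Reasoning
  bin-absorb (suc n) (suc k) = begin
    suc (suc k) * (bin (suc n) (suc k) + bin (suc n) (suc (suc k)))
      ≡⟨ *-distribˡ-+ (suc (suc k)) (bin (suc n) (suc k)) _ ⟩
    suc (suc k) * bin (suc n) (suc k) + suc (suc k) * bin (suc n) (suc (suc k))
      ≡⟨ cong (suc (suc k) * bin (suc n) (suc k) +_) (bin-absorb n (suc k)) ⟩
    (bin (suc n) (suc k) + suc k * bin (suc n) (suc k)) + suc n * bin n (suc k)
      ≡⟨ cong (λ z → (bin (suc n) (suc k) + z) + suc n * bin n (suc k)) (bin-absorb n k) ⟩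
    (bin (suc n) (suc k) + suc n * bin n k) + suc n * bin n (suc k)
      ≡⟨ regroup (bin (suc n) (suc k)) (suc n) (bin n k) (bin n (suc k)) ⟩
    bin (suc n) (suc k) + suc n * (bin n k + bin n (suc k)) ∎
    where
    open ≡-Reasoning
    regroup : ∀ x y z w → (x + y * z) + y * w ≡ x + y * (z + w)
    regroup = solve-∀

  [m*n]^e : ∀ m n e → (m * n) ^ e ≡ m ^ e * n ^ e
  [m*n]^e m n zero = refl
  [m*n]^e m n (suc e) = trans (cong (m * n *_) ([m*n]^e m n e)) (regroup m n (m ^ e) (n ^ e))
    where
    regroup : ∀ x y xe ye → x * y * (xe * ye) ≡ x * xe * (y * ye)
    regroup = solve-∀

-- Sequences w ∈ K^t counted by the number #P w of entries with a property P.
-- With a = #{x ∈ K : P x}, b = #{x ∈ K : ¬ P x} and M = |K| = a + b, exactly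
-- C(t,i) a^i b^(t-i) sequences have #P w = i (so #P w is binomially
-- distributed with p = a/M), and at most (s a / M)^j M^s sequences u ∈ K^s
-- have #P u ≥ j (the union bound over j-sets of positions).
module CountByProperty {X : Set} (K : List X) {P : X → Set} (P? : ∀ x → Dec (P x)) where

  open import Data.Nat using (ℕ; zero; suc; _+_; _*_; _≤_; _^_; _∸_; z≤n; s≤s; _≟_; _≤?_; _<?_; s≤s⁻¹)
  open import Data.Nat.Properties
  open import Data.Nat.Tactic.RingSolver
  open import Data.List using (length; filter; upTo)
  open import Data.Vec using (Vec; []; _∷_; toList)
  open import Relation.Nullary using (yes; no)
  open import Relation.Binary.PropositionalEquality
  open import Defs using (seqs)
  open Sums
  open Binomial

  a b M : ℕ
  a = Σ K (λ x → ⟦ P? x ⟧)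
  b = Σ K (λ x → 1 ∸ ⟦ P? x ⟧)
  M = length K

  count : {m : ℕ} → Vec X m → ℕ
  count w = Σ (toList w) (λ x → ⟦ P? x ⟧)

  count≤ : ∀ {m} (w : Vec X m) → count w ≤ m
  count≤ [] = z≤n
  count≤ (x ∷ w) = +-mono-≤ (⟦⟧≤1 (P? x)) (count≤ w)

  Σ-split01 : (F : ℕ → ℕ) → Σ K (λ x → F ⟦ P? x ⟧) ≡ a * F 1 + b * F 0
  Σ-split01 F = begin
    Σ K (λ x → F ⟦ P? x ⟧)
      ≡⟨ Σ-cong K pointwise ⟩
    Σ K (λ x → ⟦ P? x ⟧ * F 1 + (1 ∸ ⟦ P? x ⟧) * F 0)
      ≡⟨ Σ-+ K _ _ ⟩
    Σ K (λ x → ⟦ P? x ⟧ * F 1) + Σ K (λ x → (1 ∸ ⟦ P? x ⟧) * F 0)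
      ≡⟨ cong₂ _+_ (Σ-*ʳ (F 1) K _) (Σ-*ʳ (F 0) K _) ⟩
    a * F 1 + b * F 0 ∎
    where
    open ≡-Reasoning
    pointwise : ∀ x → F ⟦ P? x ⟧ ≡ ⟦ P? x ⟧ * F 1 + (1 ∸ ⟦ P? x ⟧) * F 0
    pointwise x with P? x
    ... | yes _ = trans (sym (+-identityʳ (F 1))) (cong (_+ 0) (sym (*-identityˡ (F 1))))
    ... | no _ = sym (*-identityˡ (F 0))

  a+b≡M : a + b ≡ M
  a+b≡M = trans (sym (Σ-+ K _ _)) (trans (Σ-cong K pointwise) (sym (length≡Σ1 K)))
    where
    pointwise : ∀ x → ⟦ P? x ⟧ + (1 ∸ ⟦ P? x ⟧) ≡ 1
    pointwise x with P? x
    ... | yes _ = refl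
    ... | no _ = refl

  a≤M : a ≤ M
  a≤M = subst (a ≤_) a+b≡M (m≤m+n a b)

  b≤M : b ≤ M
  b≤M = subst (b ≤_) a+b≡M (m≤n+m b a)

  N : ℕ → ℕ → ℕ
  N t i = Σ (seqs t K) (λ w → ⟦ count w ≟ i ⟧)

  N-suc-zero : ∀ t → N (suc t) 0 ≡ b * N t 0
  N-suc-zero t = begin
    N (suc t) 0
      ≡⟨ Σ-seqs t K _ ⟩
    Σ K (λ x → Σ (seqs t K) (λ w → ⟦ ⟦ P? x ⟧ + count w ≟ 0 ⟧))
      ≡⟨ Σ-split01 (λ e → Σ (seqs t K) (λ w → ⟦ e + count w ≟ 0 ⟧)) ⟩
    a * Σ (seqs t K) (λ w → ⟦ suc (count w) ≟ 0 ⟧) + b * N t 0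
      ≡⟨ cong (λ z → a * z + b * N t 0)
           (Σ-zero (seqs t K) (λ w → ⟦no⟧ (suc (count w) ≟ 0) (λ ()))) ⟩
    a * 0 + b * N t 0
      ≡⟨ cong (_+ b * N t 0) (*-zeroʳ a) ⟩
    b * N t 0 ∎
    where open ≡-Reasoning

  N-suc-suc : ∀ t i → N (suc t) (suc i) ≡ a * N t i + b * N t (suc i)
  N-suc-suc t i = begin
    N (suc t) (suc i)
      ≡⟨ Σ-seqs t K _ ⟩
    Σ K (λ x → Σ (seqs t K) (λ w → ⟦ ⟦ P? x ⟧ + count w ≟ suc i ⟧))
      ≡⟨ Σ-split01 (λ e → Σ (seqs t K) (λ w → ⟦ e + count w ≟ suc i ⟧)) ⟩
    a * Σ (seqs t K) (λ w → ⟦ suc (count w) ≟ suc i ⟧) + b * N t (suc i)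
      ≡⟨ cong (λ z → a * z + b * N t (suc i))
           (Σ-cong (seqs t K) (λ w → ⟦⟧-iff (suc (count w) ≟ suc i) (count w ≟ i) suc-injective (cong suc))) ⟩
    a * N t i + b * N t (suc i) ∎
    where open ≡-Reasoning

  N≡binomial : ∀ t i → N t i ≡ bin t i * (a ^ i * b ^ (t ∸ i))
  N≡binomial zero zero = trans (+-identityʳ _) (⟦yes⟧ (0 ≟ 0) refl)
  N≡binomial zero (suc i) = trans (+-identityʳ _) (⟦no⟧ (0 ≟ suc i) (λ ()))
  N≡binomial (suc t) zero = begin
    N (suc t) 0                ≡⟨ N-suc-zero t ⟩
    b * N t 0                  ≡⟨ cong (b *_) (N≡binomial t 0) ⟩
    b * (1 * (1 * b ^ t))      ≡⟨ regroup b (b ^ t) ⟩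
    1 * (1 * (b * b ^ t))      ∎
    where
    open ≡-Reasoning
    regroup : ∀ x y → x * (1 * (1 * y)) ≡ 1 * (1 * (x * y))
    regroup = solve-∀
  N≡binomial (suc t) (suc j) with j <? t
  ... | yes j<t = begin
    N (suc t) (suc j)
      ≡⟨ N-suc-suc t j ⟩
    a * N t j + b * N t (suc j)
      ≡⟨ cong₂ (λ x y → a * x + b * y) (N≡binomial t j) (N≡binomial t (suc j)) ⟩
    a * (bin t j * (a ^ j * b ^ (t ∸ j))) + b * (bin t (suc j) * (a ^ suc j * b ^ (t ∸ suc j)))
      ≡⟨ cong (λ z → a * (bin t j * (a ^ j * b ^ z)) + b * (bin t (suc j) * (a ^ suc j * b ^ (t ∸ suc j)))) t∸j ⟩
    a * (bin t j * (a ^ j * (b * b ^ (t ∸ suc j)))) + b * (bin t (suc j) * (a * a ^ j * b ^ (t ∸ suc j)))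
      ≡⟨ pascal a b (bin t j) (bin t (suc j)) (a ^ j) (b ^ (t ∸ suc j)) ⟩
    (bin t j + bin t (suc j)) * (a * a ^ j * (b * b ^ (t ∸ suc j)))
      ≡⟨ cong (λ z → (bin t j + bin t (suc j)) * (a * a ^ j * b ^ z)) (sym t∸j) ⟩
    bin (suc t) (suc j) * (a ^ suc j * b ^ (t ∸ j)) ∎
    where
    open ≡-Reasoning
    t∸j : t ∸ j ≡ suc (t ∸ suc j)
    t∸j = +-∸-assoc 1 j<t
    pascal : ∀ a b B₁ B₂ aj be →
      a * (B₁ * (aj * (b * be))) + b * (B₂ * (a * aj * be)) ≡ (B₁ + B₂) * (a * aj * (b * be))
    pascal = solve-∀
  ... | no j≮t = begin
    N (suc t) (suc j)
      ≡⟨ N-suc-suc t j ⟩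
    a * N t j + b * N t (suc j)
      ≡⟨ cong₂ (λ x y → a * x + b * y) (N≡binomial t j) (N≡binomial t (suc j)) ⟩
    a * (bin t j * (a ^ j * b ^ (t ∸ j))) + b * (bin t (suc j) * (a ^ suc j * b ^ (t ∸ suc j)))
      ≡⟨ cong₂ (λ z y → a * (bin t j * (a ^ j * b ^ z)) + b * (y * (a ^ suc j * b ^ (t ∸ suc j))))
               t∸j≡0 bin-t-[j+1]≡0 ⟩
    a * (bin t j * (a ^ j * 1)) + b * (0 * (a ^ suc j * b ^ (t ∸ suc j)))
      ≡⟨ regroup a b (bin t j) (a ^ j) (a ^ suc j * b ^ (t ∸ suc j)) ⟩
    (bin t j + 0) * (a * a ^ j * 1)
      ≡⟨ cong₂ (λ y z → (bin t j + y) * (a * a ^ j * b ^ z)) (sym bin-t-[j+1]≡0) (sym t∸j≡0) ⟩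
    bin (suc t) (suc j) * (a ^ suc j * b ^ (t ∸ j)) ∎
    where
    open ≡-Reasoning
    t≤j : t ≤ j
    t≤j = ≮⇒≥ j≮t
    t∸j≡0 : t ∸ j ≡ 0
    t∸j≡0 = m≤n⇒m∸n≡0 t≤j
    bin-t-[j+1]≡0 : bin t (suc j) ≡ 0
    bin-t-[j+1]≡0 = bin-0 t (suc j) (s≤s t≤j)
    regroup : ∀ a b B₁ aj r → a * (B₁ * (aj * 1)) + b * (0 * r) ≡ (B₁ + 0) * (a * aj * 1)
    regroup = solve-∀

  count-by-value : ∀ t {Q : ℕ → Set} (Q? : ∀ i → Dec (Q i)) →
    Σ (seqs t K) (λ w → ⟦ Q? (count w) ⟧) ≡ Σ (filter Q? (upTo (suc t))) (N t)
  count-by-value t Q? = sym (begin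
    Σ (filter Q? (upTo (suc t))) (N t)
      ≡⟨ Σ-filter Q? (upTo (suc t)) (N t) ⟩
    Σ (upTo (suc t)) (λ i → ⟦ Q? i ⟧ * Σ (seqs t K) (λ w → ⟦ count w ≟ i ⟧))
      ≡⟨ Σ-cong (upTo (suc t)) (λ i → sym (Σ-*ˡ ⟦ Q? i ⟧ (seqs t K) _)) ⟩
    Σ (upTo (suc t)) (λ i → Σ (seqs t K) (λ w → ⟦ Q? i ⟧ * ⟦ count w ≟ i ⟧))
      ≡⟨ Σ-swap (upTo (suc t)) (seqs t K) _ ⟩
    Σ (seqs t K) (λ w → Σ (upTo (suc t)) (λ i → ⟦ Q? i ⟧ * ⟦ count w ≟ i ⟧))
      ≡⟨ Σ-cong (seqs t K) (λ w → trans (Σ-cong (upTo (suc t)) (λ i → *-comm ⟦ Q? i ⟧ _))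
            (Σ-upTo-pick t (count w) (λ i → ⟦ Q? i ⟧) (count≤ w))) ⟩
    Σ (seqs t K) (λ w → ⟦ Q? (count w) ⟧) ∎)
    where open ≡-Reasoning

  U : ℕ → ℕ → ℕ
  U s j = Σ (seqs s K) (λ u → ⟦ j ≤? count u ⟧)

  U-zero : ∀ s → U s 0 ≡ M ^ s
  U-zero s = trans (Σ-cong (seqs s K) (λ w → ⟦yes⟧ (0 ≤? count w) z≤n))
                   (trans (Σ-seqs-const s K 1) (*-identityʳ _))

  U-suc-suc : ∀ s j → U (suc s) (suc j) ≡ a * U s j + b * U s (suc j)
  U-suc-suc s j = begin
    U (suc s) (suc j)
      ≡⟨ Σ-seqs s K _ ⟩
    Σ K (λ x → Σ (seqs s K) (λ w → ⟦ suc j ≤? ⟦ P? x ⟧ + count w ⟧))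
      ≡⟨ Σ-split01 (λ e → Σ (seqs s K) (λ w → ⟦ suc j ≤? e + count w ⟧)) ⟩
    a * Σ (seqs s K) (λ w → ⟦ suc j ≤? suc (count w) ⟧) + b * U s (suc j)
      ≡⟨ cong (λ z → a * z + b * U s (suc j))
           (Σ-cong (seqs s K) (λ w → ⟦⟧-iff (suc j ≤? suc (count w)) (j ≤? count w) s≤s⁻¹ s≤s)) ⟩
    a * U s j + b * U s (suc j) ∎
    where open ≡-Reasoning

  -- Pr(#P u ≥ j) ≤ (s a/M)^j, cleared of denominators
  U-bound : ∀ s j → U s j * M ^ j ≤ s ^ j * a ^ j * M ^ s
  U-bound s zero = ≤-reflexive (trans (*-identityʳ _) (trans (U-zero s) (sym (*-identityˡ _))))
  U-bound zero (suc j) = ≤-reflexive (cong (λ z → (z + 0) * M ^ suc j) (⟦no⟧ (suc j ≤? 0) (λ ())))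
  U-bound (suc s) (suc j) = begin
    U (suc s) (suc j) * (M * M ^ j)
      ≡⟨ cong (_* (M * M ^ j)) (U-suc-suc s j) ⟩
    (a * U s j + b * U s (suc j)) * (M * Mj)
      ≤⟨ *-monoˡ-≤ (M * Mj) (+-monoʳ-≤ (a * U s j) (*-monoˡ-≤ (U s (suc j)) b≤M)) ⟩
    (a * U s j + M * U s (suc j)) * (M * Mj)
      ≡⟨ expand a (U s j) M (U s (suc j)) Mj ⟩
    a * M * (U s j * Mj) + M * (U s (suc j) * (M * Mj))
      ≤⟨ +-mono-≤ (*-monoʳ-≤ (a * M) (U-bound s j)) (*-monoʳ-≤ M (U-bound s (suc j))) ⟩
    a * M * (sj * aj * Ms) + M * ((s * sj) * (a * aj) * Ms)
      ≡⟨ collect a M sj aj Ms s ⟩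
    (suc s * sj) * (a * aj) * (M * Ms)
      ≤⟨ *-monoˡ-≤ (M * Ms) (*-monoˡ-≤ (a * aj) (*-monoʳ-≤ (suc s) (^-monoˡ-≤ j (n≤1+n s)))) ⟩
    (suc s * suc s ^ j) * (a * aj) * (M * Ms) ∎
    where
    open ≤-Reasoning
    Mj = M ^ j
    Ms = M ^ s
    sj = s ^ j
    aj = a ^ j
    expand : ∀ a X M Y Mj → (a * X + M * Y) * (M * Mj) ≡ a * M * (X * Mj) + M * (Y * (M * Mj))
    expand = solve-∀
    collect : ∀ a M sj aj Ms s →
      a * M * (sj * aj * Ms) + M * ((s * sj) * (a * aj) * Ms) ≡ (suc s * sj) * (a * aj) * (M * Ms)
    collect = solve-∀

-- The family K = ([n] choose k): |K| = C(n,k), and every vertex of [n] = [1+n']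
-- lies in the same number `through n' k` = C(n', k-1) of its members, so that
-- k |K| = n · through n' k, i.e. a vertex is covered with probability k/n.
module KSets where

  open import Data.Nat using (ℕ; zero; suc; _+_; _*_; _≟_)
  open import Data.Nat.Properties
  open import Data.List using (length)
  open import Data.Fin using (Fin; zero; suc)
  open import Data.Fin.Subset using (Subset; ∣_∣; inside; outside)
  open import Data.Fin.Subset.Properties using (_∈?_)
  open import Relation.Binary.PropositionalEquality
  open import Defs
  open Sums
  open Multisets
  open Binomial

  private
    sized : ℕ → ℕ → ℕ
    sized n k = Σ (allSubsets n) (λ A → ⟦ ∣ A ∣ ≟ k ⟧)

    sizedThrough : (n : ℕ) → ℕ → Fin n → ℕ
    sizedThrough n k v = Σ (allSubsets n) (λ A → ⟦ ∣ A ∣ ≟ k ⟧ * ⟦ v ∈? A ⟧)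

    ⟦suc≟0⟧ : ∀ x → ⟦ suc x ≟ 0 ⟧ ≡ 0
    ⟦suc≟0⟧ x = ⟦no⟧ (suc x ≟ 0) (λ ())

    ⟦suc≟suc⟧ : ∀ x k → ⟦ suc x ≟ suc k ⟧ ≡ ⟦ x ≟ k ⟧
    ⟦suc≟suc⟧ x k = ⟦⟧-iff (suc x ≟ suc k) (x ≟ k) suc-injective (cong suc)

    sized≡bin : ∀ n k → sized n k ≡ bin n k
    sized≡bin zero zero = refl
    sized≡bin zero (suc k) = refl
    sized≡bin (suc n) zero = begin
      sized (suc n) 0 ≡⟨ Σ-allSubsets n _ ⟩
      sized n 0 + Σ (allSubsets n) (λ A → ⟦ suc ∣ A ∣ ≟ 0 ⟧)
        ≡⟨ cong₂ _+_ (sized≡bin n 0) (Σ-zero (allSubsets n) (λ A → ⟦suc≟0⟧ ∣ A ∣)) ⟩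
      1 ∎
      where open ≡-Reasoning
    sized≡bin (suc n) (suc k) = begin
      sized (suc n) (suc k) ≡⟨ Σ-allSubsets n _ ⟩
      sized n (suc k) + Σ (allSubsets n) (λ A → ⟦ suc ∣ A ∣ ≟ suc k ⟧)
        ≡⟨ cong (sized n (suc k) +_) (Σ-cong (allSubsets n) (λ A → ⟦suc≟suc⟧ ∣ A ∣ k)) ⟩
      sized n (suc k) + sized n k ≡⟨ cong₂ _+_ (sized≡bin n (suc k)) (sized≡bin n k) ⟩
      bin n (suc k) + bin n k ≡⟨ +-comm (bin n (suc k)) (bin n k) ⟩
      bin (suc n) (suc k) ∎
      where open ≡-Reasoning

    -- the first coordinate: the subsets through vertex 0 are the inside ∷ A
    through-zero : ∀ n k → sizedThrough (suc n) k zero ≡ Σ (allSubsets n) (λ A → ⟦ suc ∣ A ∣ ≟ k ⟧)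
    through-zero n k = trans (Σ-allSubsets n _) (cong₂ _+_
      (Σ-zero (allSubsets n) (λ A → *-zeroʳ ⟦ ∣ A ∣ ≟ k ⟧))
      (Σ-cong (allSubsets n) (λ A → *-identityʳ _)))

    through-suc : ∀ n k (v : Fin n) → sizedThrough (suc n) k (suc v) ≡
      sizedThrough n k v + Σ (allSubsets n) (λ A → ⟦ suc ∣ A ∣ ≟ k ⟧ * ⟦ v ∈? A ⟧)
    through-suc n k v = trans (Σ-allSubsets n _) (cong₂ _+_
      (Σ-cong (allSubsets n) (λ A → cong (⟦ ∣ A ∣ ≟ k ⟧ *_) (⟦suc∈⟧ v outside A)))
      (Σ-cong (allSubsets n) (λ A → cong (⟦ suc ∣ A ∣ ≟ k ⟧ *_) (⟦suc∈⟧ v inside A))))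

    shift-0 : ∀ n (g : Subset n → ℕ) → Σ (allSubsets n) (λ A → ⟦ suc ∣ A ∣ ≟ 0 ⟧ * g A) ≡ 0
    shift-0 n g = Σ-zero (allSubsets n) (λ A → cong (_* g A) (⟦suc≟0⟧ ∣ A ∣))

    shift-suc : ∀ n k (g : Subset n → ℕ) →
      Σ (allSubsets n) (λ A → ⟦ suc ∣ A ∣ ≟ suc k ⟧ * g A) ≡ Σ (allSubsets n) (λ A → ⟦ ∣ A ∣ ≟ k ⟧ * g A)
    shift-suc n k g = Σ-cong (allSubsets n) (λ A → cong (_* g A) (⟦suc≟suc⟧ ∣ A ∣ k))

    through-0 : ∀ n v → sizedThrough (suc n) 0 v ≡ 0
    through-0 n zero =
      trans (through-zero n 0) (trans (Σ-cong (allSubsets n) (λ A → sym (*-identityʳ _))) (shift-0 n (λ _ → 1)))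
    through-0 (suc n) (suc v) =
      trans (through-suc (suc n) 0 v) (cong₂ _+_ (through-0 n v) (shift-0 (suc n) (λ A → ⟦ v ∈? A ⟧)))

    through-suc-k : ∀ n k v → sizedThrough (suc n) (suc k) v ≡ bin n k
    through-suc-k n k zero =
      trans (through-zero n (suc k)) (trans (Σ-cong (allSubsets n) (λ A → ⟦suc≟suc⟧ ∣ A ∣ k)) (sized≡bin n k))
    through-suc-k (suc n) zero (suc v) = trans (through-suc (suc n) 1 v)
      (cong₂ _+_ (through-suc-k n 0 v) (trans (shift-suc (suc n) 0 (λ A → ⟦ v ∈? A ⟧)) (through-0 n v)))
    through-suc-k (suc n) (suc k) (suc v) = trans (through-suc (suc n) (suc (suc k)) v)
      (trans (cong₂ _+_ (through-suc-k n (suc k) v)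
                        (trans (shift-suc (suc n) (suc k) (λ A → ⟦ v ∈? A ⟧)) (through-suc-k n k v)))
             (+-comm (bin n (suc k)) (bin n k)))

  length-kSets : ∀ n k → length (kSets n k) ≡ bin n k
  length-kSets n k = trans (length-filter (λ A → ∣ A ∣ ≟ k) (allSubsets n)) (sized≡bin n k)

  through : ℕ → ℕ → ℕ
  through n' zero = 0
  through n' (suc k) = bin n' k

  deg-kSets : ∀ n' k v → deg (kSets (suc n') k) v ≡ through n' k
  deg-kSets n' k v =
    trans (Σ-filter (λ A → ∣ A ∣ ≟ k) (allSubsets (suc n')) (λ A → ⟦ v ∈? A ⟧)) (by-size k)
    where
    by-size : ∀ k → sizedThrough (suc n') k v ≡ through n' k
    by-size zero = through-0 n' v
    by-size (suc k) = through-suc-k n' k v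

  -- the two counts of incidences (v, A), v ∈ A ∈ K, agree; by absorption
  k*|K|≡through*n : ∀ n' k → k * length (kSets (suc n') k) ≡ through n' k * suc n'
  k*|K|≡through*n n' zero = refl
  k*|K|≡through*n n' (suc k) = trans (cong (suc k *_) (length-kSets (suc n') (suc k)))
    (trans (bin-absorb n' k) (*-comm (suc n') (bin n' k)))

-- The binomial distribution with success probability p = a/M, a + b = M, as
-- a count: Pr(B(t,p) = i) = C(t,i) a^i b^(t-i) / M^t, so a tail probability is
-- (a sum of such counts) / M^t.
module BinomialAsCount (a b M : ℕ) (M≥1 : 1 ℕ.≤ M) (a+b≡M : a ℕ.+ b ≡ M)
  (p : ℚ) (p≡a/M : p ≡ ratio a M) where

  open import Data.Nat as ℕ using (ℕ; suc; _^_; _∸_; z≤n; s≤s)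
  import Data.Nat.Properties as ℕP
  open import Data.Nat.Combinatorics using (_C_)
  open import Data.Nat.Tactic.RingSolver
  open import Relation.Binary.PropositionalEquality
  open import Data.Rational using (0ℚ; 1ℚ; _+_; _-_; _*_; -_)
  open import Data.Rational.Properties using (+-assoc; +-inverseʳ; +-identityʳ)
  open import Data.List using (_∷_; []; map; foldr; filter; upTo)
  open import Data.List.Membership.Propositional using (_∈_)
  open import Data.List.Membership.Propositional.Properties using (∈-filter⁻; ∈-upTo⁻)
  open import Data.List.Relation.Unary.Any using (here; there)
  open import Data.Product using (proj₁)
  open import Defs using (binomPMF; binomTail; fromℕ; pow)
  open Sums using (Σ)
  open Binomial
  open Fractions

  q≡b/M : 1ℚ - p ≡ ratio b M
  q≡b/M = begin
    1ℚ - p                           ≡⟨ cong₂ _-_ one p≡a/M ⟩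
    ratio (b ℕ.+ a) M - ratio a M    ≡⟨ cong (_- ratio a M) (sym (ratio-+ M≥1)) ⟩
    (ratio b M + ratio a M) - ratio a M
      ≡⟨ +-assoc (ratio b M) (ratio a M) (- ratio a M) ⟩
    ratio b M + (ratio a M - ratio a M)
      ≡⟨ trans (cong (ratio b M +_) (+-inverseʳ (ratio a M))) (+-identityʳ (ratio b M)) ⟩
    ratio b M ∎
    where
    open ≡-Reasoning
    one : 1ℚ ≡ ratio (b ℕ.+ a) M
    one = ratio-cong 1 1 (b ℕ.+ a) M (s≤s z≤n) M≥1
      (trans (ℕP.*-identityˡ M) (trans (sym a+b≡M) (trans (ℕP.+-comm a b) (sym (ℕP.*-identityʳ _)))))

  G : ℕ → ℕ → ℕ
  G t i = bin t i ℕ.* (a ^ i ℕ.* b ^ (t ∸ i))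

  pmf≡ : ∀ t i → i ℕ.≤ t → binomPMF t p i ≡ ratio (G t i) (M ^ t)
  pmf≡ t i i≤t = begin
    fromℕ (t C i) * pow p i * pow (1ℚ - p) r
      ≡⟨ cong₂ (λ x y → fromℕ (t C i) * pow x i * pow y r) p≡a/M q≡b/M ⟩
    ratio (t C i) 1 * pow (ratio a M) i * pow (ratio b M) r
      ≡⟨ cong₂ (λ x y → ratio (t C i) 1 * x * y) (ratio-pow i M≥1) (ratio-pow r M≥1) ⟩
    ratio (t C i) 1 * ratio (a ^ i) (M ^ i) * ratio (b ^ r) (M ^ r)
      ≡⟨ cong (_* ratio (b ^ r) (M ^ r)) (ratio-* {t C i} {1} {a ^ i} {M ^ i} 1≤1 1≤M^i) ⟩
    ratio ((t C i) ℕ.* a ^ i) (1 ℕ.* M ^ i) * ratio (b ^ r) (M ^ r)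
      ≡⟨ ratio-* {(t C i) ℕ.* a ^ i} {1 ℕ.* M ^ i} {b ^ r} {M ^ r} (1≤* {1} {M ^ i} 1≤1 1≤M^i) 1≤M^r ⟩
    ratio ((t C i) ℕ.* a ^ i ℕ.* b ^ r) (1 ℕ.* M ^ i ℕ.* M ^ r)
      ≡⟨ ratio-cong _ (1 ℕ.* M ^ i ℕ.* M ^ r) _ (M ^ t) (1≤* (1≤* {1} {M ^ i} 1≤1 1≤M^i) 1≤M^r) (1≤^ t M≥1) cross ⟩
    ratio (G t i) (M ^ t) ∎
    where
    open ≡-Reasoning
    r : ℕ
    r = t ∸ i
    1≤1 : 1 ℕ.≤ 1
    1≤1 = s≤s z≤n
    1≤M^i : 1 ℕ.≤ M ^ i
    1≤M^i = 1≤^ i M≥1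
    1≤M^r : 1 ℕ.≤ M ^ r
    1≤M^r = 1≤^ r M≥1
    M^t : M ^ t ≡ M ^ i ℕ.* M ^ r
    M^t = trans (cong (M ^_) (sym (ℕP.m+[n∸m]≡n i≤t))) (ℕP.^-distribˡ-+-* M i r)
    regroup : ∀ c ai be mi me → c ℕ.* ai ℕ.* be ℕ.* (mi ℕ.* me) ≡ c ℕ.* (ai ℕ.* be) ℕ.* (1 ℕ.* mi ℕ.* me)
    regroup = solve-∀
    cross : (t C i) ℕ.* a ^ i ℕ.* b ^ r ℕ.* M ^ t ≡ G t i ℕ.* (1 ℕ.* M ^ i ℕ.* M ^ r)
    cross = trans (cong ((t C i) ℕ.* a ^ i ℕ.* b ^ r ℕ.*_) M^t)
      (trans (regroup (t C i) (a ^ i) (b ^ r) (M ^ i) (M ^ r))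
        (cong (λ c → c ℕ.* (a ^ i ℕ.* b ^ r) ℕ.* (1 ℕ.* M ^ i ℕ.* M ^ r)) (C≡bin t i)))

  private
    Σ-ratio : ∀ (xs : List ℕ) (F : ℕ → ℚ) (g : ℕ → ℕ) D → 1 ℕ.≤ D →
      (∀ i → i ∈ xs → F i ≡ ratio (g i) D) → foldr _+_ 0ℚ (map F xs) ≡ ratio (Σ xs g) D
    Σ-ratio [] F g D D≥1 h = ratio-cong 0 1 0 D (s≤s z≤n) D≥1 refl
    Σ-ratio (x ∷ xs) F g D D≥1 h =
      trans (cong₂ _+_ (h x (here refl)) (Σ-ratio xs F g D D≥1 (λ i i∈ → h i (there i∈))))
            (ratio-+ D≥1)

  tail≡ : ∀ t α C → binomTail t p α C ≡
    ratio (Σ (filter (λ i → α ℕP.≤? i ℕ.+ C) (upTo (suc t))) (G t)) (M ^ t)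
  tail≡ t α C = Σ-ratio range (binomPMF t p) (G t) (M ^ t) (1≤^ t M≥1)
    (λ i i∈ → pmf≡ t i (in-range i∈))
    where
    range = filter (λ i → α ℕP.≤? i ℕ.+ C) (upTo (suc t))
    in-range : ∀ {i} → i ∈ range → i ℕ.≤ t
    in-range i∈ = ℕP.≤-pred (∈-upTo⁻ (proj₁ (∈-filter⁻ (λ i → α ℕP.≤? i ℕ.+ C) {xs = upTo (suc t)} i∈)))

module Space (n' k : ℕ) (k≤n : k ℕ.≤ ℕ.suc n') where

  open import Data.Nat using (suc; _+_; _*_; _≤_; _∸_)
  open import Data.Nat.Properties
  open import Data.Bool using (true; false)
  open import Data.List using (List; []; _∷_; length)
  open import Data.List.Relation.Unary.All using (All; []; _∷_)
  open import Data.Fin using (Fin; zero; suc)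
  open import Data.Fin.Subset using (Subset; ∣_∣)
  open import Data.Fin.Subset.Properties using (_∈?_)
  open import Data.Vec using (_∷_; [])
  open import Relation.Binary.PropositionalEquality
  open import Defs using (kSets)
  open Sums
  open Multisets
  open Binomial
  open KSets

  n : ℕ
  n = suc n'

  K : List (Subset n)
  K = kSets n k

  M : ℕ
  M = length K

  M≥1 : 1 ≤ M
  M≥1 = subst (1 ≤_) (sym (length-kSets n k)) (bin≥1 n k k≤n)

  a : ℕ
  a = through n' k

  k*M≡a*n : k * M ≡ a * n
  k*M≡a*n = k*|K|≡through*n n' k

  module ByVertex (v : Fin n) = CountByProperty K (v ∈?_)

  a-at : ∀ v → ByVertex.a v ≡ a
  a-at = deg-kSets n' k

  b : ℕ
  b = M ∸ a

  a+b≡M : a + b ≡ M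
  a+b≡M = m+[n∸m]≡n (subst (_≤ M) (a-at zero) (ByVertex.a≤M zero))

  b-at : ∀ v → ByVertex.b v ≡ b
  b-at v = begin
    ByVertex.b v                                  ≡⟨ sym (m+n∸m≡n (ByVertex.a v) (ByVertex.b v)) ⟩
    (ByVertex.a v + ByVertex.b v) ∸ ByVertex.a v  ≡⟨ cong₂ _∸_ (ByVertex.a+b≡M v) (a-at v) ⟩
    M ∸ a                                         ∎
    where open ≡-Reasoning

  Σ-deg : (L : List (Subset n)) → All (λ A → ∣ A ∣ ≡ k) L → ΣF n (deg L) ≡ length L * k
  Σ-deg L hk = trans (ΣF-swap n L (λ v A → ⟦ v ∈? A ⟧)) (trans (Σ-cong L (size n)) (Σ-size L hk))
    where
    size : ∀ n (A : Subset n) → ΣF n (λ v → ⟦ v ∈? A ⟧) ≡ ∣ A ∣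
    size ℕ.zero [] = refl
    size (suc n) (true ∷ A) = cong suc (trans (ΣF-cong n (λ v → ⟦suc∈⟧ v true A)) (size n A))
    size (suc n) (false ∷ A) = trans (ΣF-cong n (λ v → ⟦suc∈⟧ v false A)) (size n A)
    Σ-size : (L : List (Subset n)) → All (λ A → ∣ A ∣ ≡ k) L → Σ L ∣_∣ ≡ length L * k
    Σ-size [] [] = refl
    Σ-size (A ∷ L) (e ∷ es) = cong₂ _+_ e (Σ-size L es)

module Comparison (n' k : ℕ) (k≤n : k ℕ.≤ ℕ.suc n') (α C : ℕ) where

  open import Data.Nat using (suc; _+_; _*_; _≤_; _^_; _∸_; z≤n; s≤s; _≤?_)
  open import Data.Nat.Properties
  open import Data.List using (List; length; filter; upTo)
  open import Data.List.Relation.Unary.All using (All)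
  open import Data.Vec using (toList)
  import Data.Fin.Properties as FinP
  open import Data.Fin.Subset using (Subset; ∣_∣)
  open import Data.Product using (_,_)
  open import Relation.Nullary using (yes; no)
  open import Relation.Binary.PropositionalEquality
  open import Defs using (seqs)
  open Sums
  open Multisets
  open Binomial
  open Space n' k k≤n public

  Δ≤α? : (w : List (Subset n)) → Dec (∀ v → deg w v ≤ α)
  Δ≤α? w = FinP.all? (λ v → deg w v ≤? α)

  Δ∪≤α? : (u w : List (Subset n)) → Dec (∀ v → deg u v + deg w v ≤ α)
  Δ∪≤α? u w = FinP.all? (λ v → deg u v + deg w v ≤? α)

  completions : ℕ → List (Subset n) → ℕ
  completions t u = Σ (seqs t K) (λ w → ⟦ Δ∪≤α? u (toList w) ⟧)

  good : ℕ → ℕ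
  good t = Σ (seqs t K) (λ w → ⟦ Δ≤α? (toList w) ⟧)

  completions≤good : ∀ t u → completions t u ≤ good t
  completions≤good t u = Σ-mono (seqs t K) (λ w → ⟦⟧-mono (Δ∪≤α? u (toList w)) (Δ≤α? (toList w))
    (λ h v → ≤-trans (m≤n+m _ _) (h v)))

  good≤M^t : ∀ t → good t ≤ M ^ t
  good≤M^t t = ≤-trans (Σ-mono (seqs t K) (λ w → ⟦⟧≤1 (Δ≤α? (toList w))))
    (≤-reflexive (trans (Σ-seqs-const t K 1) (*-identityʳ _)))

  -- T t = M^t · Pr(B(t, k/n) ≥ α - C), as a count
  open BinomialAsCount a b M M≥1 a+b≡M (ratio a M) refl public using (G; tail≡)

  heavy? : (i : ℕ) → Dec (α ≤ i + C)
  heavy? i = α ≤? i + C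

  T : ℕ → ℕ
  T t = Σ (filter heavy? (upTo (suc t))) (G t)

  heavy-at : ∀ t v → Σ (seqs t K) (λ w → ⟦ heavy? (deg (toList w) v) ⟧) ≡ T t
  heavy-at t v = trans (ByVertex.count-by-value v t heavy?) (Σ-cong (filter heavy? (upTo (suc t)))
    (λ i → trans (ByVertex.N≡binomial v t i)
                 (cong₂ (λ x y → bin t i * (x ^ i * y ^ (t ∸ i))) (a-at v) (b-at v))))

  -- if Δ(u) ≤ C, a w with Δ(w) ≤ α but Δ(u ∪ w) > α is heavy at a vertex covered by u
  good-not-completion : ∀ (u w : List (Subset n)) → (∀ v → deg u v ≤ C) →
    ⟦ Δ≤α? w ⟧ ≤ ⟦ Δ∪≤α? u w ⟧ + ΣF n (λ v → ⟦ 1 ≤? deg u v ⟧ * ⟦ heavy? (deg w v) ⟧)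
  good-not-completion u w Δu≤C with Δ≤α? w | Δ∪≤α? u w
  ... | no _ | _ = z≤n
  ... | yes _ | yes _ = m≤m+n 1 _
  ... | yes Δw≤α | no ¬Δ∪≤α with FinP.¬∀⟶∃¬ n _ (λ v → deg u v + deg w v ≤? α) ¬Δ∪≤α
  ... | v , ¬≤ = ≤-trans (≤-reflexive (sym witness))
                   (ΣF-≥ n (λ v → ⟦ 1 ≤? deg u v ⟧ * ⟦ heavy? (deg w v) ⟧) v)
    where
    x = deg u v
    y = deg w v
    α<x+y : suc α ≤ x + y
    α<x+y = ≰⇒> ¬≤
    covered : 1 ≤ x
    covered = +-cancelʳ-≤ y 1 x (≤-trans (s≤s (Δw≤α v)) α<x+y)
    heavy : α ≤ y + C
    heavy = ≤-trans (n≤1+n α)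
      (≤-trans α<x+y (≤-trans (+-monoˡ-≤ y (Δu≤C v)) (≤-reflexive (+-comm C y))))
    witness : ⟦ 1 ≤? x ⟧ * ⟦ heavy? y ⟧ ≡ 1
    witness = cong₂ _*_ (⟦yes⟧ (1 ≤? x) covered) (⟦yes⟧ (heavy? y) heavy)

  good≤completions+ : ∀ t u → (∀ v → deg u v ≤ C) → All (λ A → ∣ A ∣ ≡ k) u →
    good t ≤ completions t u + length u * k * T t
  good≤completions+ t u Δu≤C sizes = begin
    good t
      ≤⟨ Σ-mono W (λ w → good-not-completion u (toList w) Δu≤C) ⟩
    Σ W (λ w → ⟦ Δ∪≤α? u (toList w) ⟧ + ΣF n (λ v → ⟦ 1 ≤? deg u v ⟧ * ⟦ heavy? (deg (toList w) v) ⟧))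
      ≡⟨ Σ-+ W _ _ ⟩
    completions t u + Σ W (λ w → ΣF n (λ v → ⟦ 1 ≤? deg u v ⟧ * ⟦ heavy? (deg (toList w) v) ⟧))
      ≡⟨ cong (completions t u +_)
           (sym (ΣF-swap n W (λ v w → ⟦ 1 ≤? deg u v ⟧ * ⟦ heavy? (deg (toList w) v) ⟧))) ⟩
    completions t u + ΣF n (λ v → Σ W (λ w → ⟦ 1 ≤? deg u v ⟧ * ⟦ heavy? (deg (toList w) v) ⟧))
      ≡⟨ cong (completions t u +_) (ΣF-cong n (λ v →
           trans (Σ-*ˡ ⟦ 1 ≤? deg u v ⟧ W _) (cong (⟦ 1 ≤? deg u v ⟧ *_) (heavy-at t v)))) ⟩
    completions t u + ΣF n (λ v → ⟦ 1 ≤? deg u v ⟧ * T t)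
      ≤⟨ +-monoʳ-≤ (completions t u) (ΣF-mono n (λ v → *-monoˡ-≤ (T t) (⟦1≤?⟧≤ (deg u v)))) ⟩
    completions t u + ΣF n (λ v → deg u v * T t)
      ≡⟨ cong (completions t u +_) (trans (ΣF-*ʳ n (deg u) (T t)) (cong (_* T t) (Σ-deg u sizes))) ⟩
    completions t u + length u * k * T t ∎
    where
    open ≤-Reasoning
    W = seqs t K
    ⟦1≤?⟧≤ : ∀ x → ⟦ 1 ≤? x ⟧ ≤ x
    ⟦1≤?⟧≤ ℕ.zero = z≤n
    ⟦1≤?⟧≤ (suc x) = s≤s z≤n

  overloaded : List (Subset n) → ℕ
  overloaded u = ΣF n (λ v → ⟦ suc C ≤? deg u v ⟧)

  good≤completions+overloaded : ∀ t u → All (λ A → ∣ A ∣ ≡ k) u →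
    good t ≤ completions t u + overloaded u * M ^ t + length u * k * T t
  good≤completions+overloaded t u sizes with FinP.all? (λ v → deg u v ≤? C)
  ... | yes Δu≤C = ≤-trans (good≤completions+ t u Δu≤C sizes)
                     (+-monoˡ-≤ (length u * k * T t) (m≤m+n (completions t u) _))
  ... | no ¬Δu≤C with FinP.¬∀⟶∃¬ n _ (λ v → deg u v ≤? C) ¬Δu≤C
  ... | v , ¬≤ = begin
    good t                                        ≤⟨ good≤M^t t ⟩
    M ^ t                                         ≡⟨ sym (*-identityˡ _) ⟩
    1 * M ^ t                                     ≤⟨ *-monoˡ-≤ (M ^ t) some-overloaded ⟩
    overloaded u * M ^ t                          ≤⟨ m≤n+m _ (completions t u) ⟩
    completions t u + overloaded u * M ^ t        ≤⟨ m≤m+n _ _ ⟩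
    completions t u + overloaded u * M ^ t + length u * k * T t ∎
    where
    open ≤-Reasoning
    some-overloaded : 1 ≤ overloaded u
    some-overloaded = ≤-trans (≤-reflexive (sym (⟦yes⟧ (suc C ≤? deg u v) (≰⇒> ¬≤))))
                              (ΣF-≥ n (λ v → ⟦ suc C ≤? deg u v ⟧) v)

  -- union bound over vertices: Σ_{u ∈ K^s} overloaded u ≤ n (s k/n)^(C+1) M^s, cleared of denominators
  Σ-overloaded : ∀ s → Σ (seqs s K) (λ u → overloaded (toList u)) * M ^ suc C ≤ n * (s ^ suc C * a ^ suc C * M ^ s)
  Σ-overloaded s = begin
    Σ (seqs s K) (λ u → overloaded (toList u)) * M ^ suc C
      ≡⟨ cong (_* M ^ suc C) (sym (ΣF-swap n (seqs s K) (λ v u → ⟦ suc C ≤? deg (toList u) v ⟧))) ⟩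
    ΣF n (λ v → ByVertex.U v s (suc C)) * M ^ suc C
      ≡⟨ sym (ΣF-*ʳ n (λ v → ByVertex.U v s (suc C)) (M ^ suc C)) ⟩
    ΣF n (λ v → ByVertex.U v s (suc C) * M ^ suc C)
      ≤⟨ ΣF-mono n (λ v → subst (λ z → ByVertex.U v s (suc C) * M ^ suc C ≤ s ^ suc C * z ^ suc C * M ^ s)
                               (a-at v) (ByVertex.U-bound v s (suc C))) ⟩
    ΣF n (λ v → s ^ suc C * a ^ suc C * M ^ s)
      ≡⟨ ΣF-const n _ ⟩
    n * (s ^ suc C * a ^ suc C * M ^ s) ∎
    where open ≤-Reasoning

module Conditioning (n' k : ℕ) (k≤n : k ℕ.≤ ℕ.suc n') (α C m : ℕ) (S : Data.Fin.Subset.Subset m)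
  (D : List (Data.Fin.Subset.Subset (ℕ.suc n'))) (|D| : Data.List.length D ≡ SplitAlongS.card S)
  (sizes : Data.List.Relation.Unary.All.All (λ A → Data.Fin.Subset.∣ A ∣ ≡ k) D)
  (Δ𝒟≤C : Defs.MaxDegreeAtMost C D) where

  open import Data.Nat using (suc; _+_; _*_; _≤_; _^_; _∸_; z≤n; s≤s; >-nonZero)
  open import Data.Nat.Properties
  open import Data.Nat.Tactic.RingSolver
  open import Data.List using (length; filter)
  open import Data.List.Relation.Unary.All using (All)
  open import Data.List.Membership.Propositional using (_∈_)
  import Data.List.Relation.Unary.All as All
  open import Data.Vec using (Vec; toList)
  open import Data.Vec.Properties using (length-toList)
  open import Data.Fin.Subset using (Subset; ∣_∣)
  open import Data.Fin.Subset.Properties using (_∈?_)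
  open import Data.Product using (_,_; Σ-syntax)
  open import Relation.Nullary using (yes; no; _×-dec_)
  open import Relation.Binary.PropositionalEquality
  import Data.Rational as ℚ
  import Data.Rational.Properties as ℚP
  open import Defs
  open Sums
  open SplitAlongS
  open Multisets
  open Fractions
  open Binomial using ([m*n]^e)
  open Comparison n' k k≤n α C

  s t : ℕ
  s = card S
  t = cocard S

  Us : List (Vec (Subset n) s)
  Us = seqs s K

  Ws : List (Vec (Subset n) t)
  Ws = seqs t K

  A_S≅𝒟? : (u : List (Subset n)) → Dec (SameMultiset u D)
  A_S≅𝒟? u = sameMultiset? u D

  #𝒟 : ℕ
  #𝒟 = Σ Us (λ u → ⟦ A_S≅𝒟? (toList u) ⟧)

  Σcompletions : ℕ
  Σcompletions = Σ Us (λ u → completions t (toList u))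

  Σoverloaded : ℕ
  Σoverloaded = Σ Us (λ u → overloaded (toList u))

  Δ-split : ∀ (ω : Vec (Subset n) m) →
    ⟦ maxDegreeAtMost? α (toList ω) ⟧ ≡ ⟦ Δ∪≤α? (restrict S ω) (restrictᶜ S ω) ⟧
  Δ-split ω = ⟦⟧-iff (maxDegreeAtMost? α (toList ω)) (Δ∪≤α? (restrict S ω) (restrictᶜ S ω))
    (λ h v → subst (_≤ α) (split v) (h v)) (λ h v → subst (_≤ α) (sym (split v)) (h v))
    where
    split : ∀ v → degree v (toList ω) ≡ deg (restrict S ω) v + deg (restrictᶜ S ω) v
    split v = trans (degree≡deg v (toList ω)) (Σ-split S ω _)

  completions-𝒟 : ∀ u → SameMultiset u D → completions t u ≡ completions t D
  completions-𝒟 u u≅D = Σ-cong Ws (λ w → ⟦⟧-iff (Δ∪≤α? u (toList w)) (Δ∪≤α? D (toList w))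
    (λ h v → subst (λ z → z + deg (toList w) v ≤ α) (same-deg v) (h v))
    (λ h v → subst (λ z → z + deg (toList w) v ≤ α) (sym (same-deg v)) (h v)))
    where
    same-deg : ∀ v → deg u v ≡ deg D v
    same-deg v = Σ-sameMultiset u D u≅D (λ A → ⟦ v ∈? A ⟧)

  #joint : length (filter (λ ω → sameMultiset? (restrict S ω) D ×-dec maxDegreeAtMost? α (toList ω)) (Ω n k m))
           ≡ #𝒟 * completions t D
  #joint = begin
    _ ≡⟨ length-filter _ (seqs m K) ⟩
    Σ (seqs m K) (λ ω → ⟦ A_S≅𝒟? (restrict S ω) ×-dec maxDegreeAtMost? α (toList ω) ⟧)
      ≡⟨ Σ-cong (seqs m K) (λ ω → trans (⟦×⟧ (A_S≅𝒟? (restrict S ω)) _)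
                                        (cong (⟦ A_S≅𝒟? (restrict S ω) ⟧ *_) (Δ-split ω))) ⟩
    Σ (seqs m K) (λ ω → ⟦ A_S≅𝒟? (restrict S ω) ⟧ * ⟦ Δ∪≤α? (restrict S ω) (restrictᶜ S ω) ⟧)
      ≡⟨ Σ-split-seqs S K (λ u w → ⟦ A_S≅𝒟? u ⟧ * ⟦ Δ∪≤α? u w ⟧) ⟩
    Σ Us (λ u → Σ Ws (λ w → ⟦ A_S≅𝒟? (toList u) ⟧ * ⟦ Δ∪≤α? (toList u) (toList w) ⟧))
      ≡⟨ Σ-cong Us (λ u → Σ-*ˡ ⟦ A_S≅𝒟? (toList u) ⟧ Ws _) ⟩
    Σ Us (λ u → ⟦ A_S≅𝒟? (toList u) ⟧ * completions t (toList u))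
      ≡⟨ Σ-cong Us only-𝒟 ⟩
    Σ Us (λ u → ⟦ A_S≅𝒟? (toList u) ⟧ * completions t D)
      ≡⟨ Σ-*ʳ (completions t D) Us _ ⟩
    #𝒟 * completions t D ∎
    where
    open ≡-Reasoning
    only-𝒟 : ∀ u → ⟦ A_S≅𝒟? (toList u) ⟧ * completions t (toList u)
                  ≡ ⟦ A_S≅𝒟? (toList u) ⟧ * completions t D
    only-𝒟 u with A_S≅𝒟? (toList u)
    ... | yes u≅D = cong (1 *_) (completions-𝒟 (toList u) u≅D)
    ... | no _ = refl

  #condition : length (filter (λ ω → sameMultiset? (restrict S ω) D) (Ω n k m)) ≡ #𝒟 * M ^ t
  #condition = begin
    _ ≡⟨ length-filter _ (seqs m K) ⟩
    Σ (seqs m K) (λ ω → ⟦ A_S≅𝒟? (restrict S ω) ⟧)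
      ≡⟨ Σ-split-seqs S K (λ u w → ⟦ A_S≅𝒟? u ⟧) ⟩
    Σ Us (λ u → Σ Ws (λ w → ⟦ A_S≅𝒟? (toList u) ⟧))
      ≡⟨ Σ-cong Us (λ u → trans (Σ-seqs-const t K _) (*-comm (M ^ t) _)) ⟩
    Σ Us (λ u → ⟦ A_S≅𝒟? (toList u) ⟧ * M ^ t)
      ≡⟨ Σ-*ʳ (M ^ t) Us _ ⟩
    #𝒟 * M ^ t ∎
    where open ≡-Reasoning

  #Δ≤α : length (filter (λ ω → maxDegreeAtMost? α (toList ω)) (Ω n k m)) ≡ Σcompletions
  #Δ≤α = trans (length-filter _ (seqs m K))
    (trans (Σ-cong (seqs m K) Δ-split) (Σ-split-seqs S K (λ u w → ⟦ Δ∪≤α? u w ⟧)))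

  #Ω : length (Ω n k m) ≡ M ^ s * M ^ t
  #Ω = trans (length-seqs m K) (trans (cong (M ^_) (sym (card+cocard S))) (^-distribˡ-+-* M s t))

  private
    as-vector : ∀ {X : Set} (s : ℕ) (L : List X) → length L ≡ s → Σ[ u ∈ Vec X s ] toList u ≡ L
    as-vector ℕ.zero List.[] refl = Vec.[] , refl
    as-vector (suc s) (x List.∷ L) e with as-vector s L (suc-injective e)
    ... | u , u≡L = (x Vec.∷ u) , cong (x List.∷_) u≡L

  -- 𝒟 itself is a possible value of A_S, so the conditioning event is nonempty
  #𝒟≥1 : 1 ≤ #𝒟
  #𝒟≥1 with as-vector s D |D|
  ... | u , u≡D = ≤-trans (≤-reflexive (sym (⟦yes⟧ (A_S≅𝒟? (toList u)) (λ A → cong (mult A) u≡D))))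
                    (Σ-seqs-≥ K s (λ u → ⟦ A_S≅𝒟? (toList u) ⟧) u
                      (subst (All _) (sym u≡D) (All.map (λ {A} e → ∈-kSets n k A e) sizes)))

  error : ℕ
  error = Σoverloaded * M ^ t + M ^ s * (s * k * T t)

  upper : M ^ s * completions t D ≤ Σcompletions + error
  upper = begin
    M ^ s * completions t D
      ≤⟨ *-monoʳ-≤ (M ^ s) (completions≤good t D) ⟩
    M ^ s * good t
      ≡⟨ sym (Σ-seqs-const s K (good t)) ⟩
    Σ Us (λ _ → good t)
      ≤⟨ Σ-seqs-mono K s _ _ pointwise ⟩
    Σ Us (λ u → completions t (toList u) + overloaded (toList u) * M ^ t + s * k * T t)
      ≡⟨ trans (Σ-+ Us _ _) (cong₂ _+_ (trans (Σ-+ Us _ _) (cong (Σcompletions +_) (Σ-*ʳ (M ^ t) Us _)))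
                                      (Σ-seqs-const s K _)) ⟩
    Σcompletions + Σoverloaded * M ^ t + M ^ s * (s * k * T t)
      ≡⟨ +-assoc Σcompletions _ _ ⟩
    Σcompletions + error ∎
    where
    open ≤-Reasoning
    pointwise : ∀ u → All (λ A → A ∈ K) (toList u) →
      good t ≤ completions t (toList u) + overloaded (toList u) * M ^ t + s * k * T t
    pointwise u u∈K = subst (λ z → good t ≤ completions t (toList u) + overloaded (toList u) * M ^ t + z * k * T t)
      (length-toList u) (good≤completions+overloaded t (toList u) (All.map (λ {A} → kSets-size n k A) u∈K))

  lower : Σcompletions ≤ M ^ s * completions t D + error
  lower = begin
    Σcompletions
      ≤⟨ Σ-mono Us (λ u → completions≤good t (toList u)) ⟩
    Σ Us (λ _ → good t)
      ≡⟨ Σ-seqs-const s K (good t) ⟩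
    M ^ s * good t
      ≤⟨ *-monoʳ-≤ (M ^ s) good≤completions-𝒟 ⟩
    M ^ s * (completions t D + s * k * T t)
      ≡⟨ *-distribˡ-+ (M ^ s) _ _ ⟩
    M ^ s * completions t D + M ^ s * (s * k * T t)
      ≤⟨ +-monoʳ-≤ (M ^ s * completions t D) (m≤n+m _ (Σoverloaded * M ^ t)) ⟩
    M ^ s * completions t D + error ∎
    where
    open ≤-Reasoning
    good≤completions-𝒟 : good t ≤ completions t D + s * k * T t
    good≤completions-𝒟 = subst (λ z → good t ≤ completions t D + z * k * T t) |D|
      (good≤completions+ t D (λ v → subst (_≤ C) (degree≡deg v D) (Δ𝒟≤C v)) sizes)
  private
    D≥1 : 1 ≤ M ^ s * M ^ t
    D≥1 = 1≤* (1≤^ s M≥1) (1≤^ t M≥1)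

  conditional≡ : PrΔ≤∣ n k m α S D ≡ ratio (M ^ s * completions t D) (M ^ s * M ^ t)
  conditional≡ = trans (cong₂ ratio #joint #condition)
    (ratio-cong (#𝒟 * completions t D) (#𝒟 * M ^ t) _ _ (1≤* #𝒟≥1 (1≤^ t M≥1)) D≥1
      (swap #𝒟 (completions t D) (M ^ s) (M ^ t)))
    where
    swap : ∀ c f u w → c * f * (u * w) ≡ u * f * (c * w)
    swap = solve-∀

  unconditional≡ : PrΔ≤ n k m α ≡ ratio Σcompletions (M ^ s * M ^ t)
  unconditional≡ = cong₂ ratio #Δ≤α #Ω

  error≡ : ratio error (M ^ s * M ^ t) ≡ ratio Σoverloaded (M ^ s) ℚ.+ ratio (s * k * T t) (M ^ t)
  error≡ = sym (trans (cong₂ ℚ._+_ first second) (ratio-+ {Σoverloaded * M ^ t} {M ^ s * skT} D≥1))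
    where
    skT = s * k * T t
    first : ratio Σoverloaded (M ^ s) ≡ ratio (Σoverloaded * M ^ t) (M ^ s * M ^ t)
    first = ratio-cong _ (M ^ s) _ (M ^ s * M ^ t) (1≤^ s M≥1) D≥1 (regroup Σoverloaded (M ^ s) (M ^ t))
      where
      regroup : ∀ x u w → x * (u * w) ≡ x * w * u
      regroup = solve-∀
    second : ratio skT (M ^ t) ≡ ratio (M ^ s * skT) (M ^ s * M ^ t)
    second = ratio-cong _ (M ^ t) _ (M ^ s * M ^ t) (1≤^ t M≥1) D≥1 (regroup skT (M ^ s) (M ^ t))
      where
      regroup : ∀ x u w → x * (u * w) ≡ u * x * w
      regroup = solve-∀

  distance≤ : ℚ.∣ PrΔ≤∣ n k m α S D ℚ.- PrΔ≤ n k m α ∣ ℚ.≤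
              ratio Σoverloaded (M ^ s) ℚ.+ ratio (s * k * T t) (M ^ t)
  distance≤ = subst₂ (λ x y → ℚ.∣ x ℚ.- y ∣ ℚ.≤ ratio Σoverloaded (M ^ s) ℚ.+ ratio (s * k * T t) (M ^ t))
    (sym conditional≡) (sym unconditional≡)
    (subst (ℚ.∣ ratio (M ^ s * completions t D) (M ^ s * M ^ t) ℚ.- ratio Σcompletions (M ^ s * M ^ t) ∣ ℚ.≤_)
           error≡ (ratio-∣-∣≤ D≥1 upper lower))

  private
    n≥1 : 1 ≤ n
    n≥1 = s≤s z≤n

  tail-term : (ρ : ℚ) → binomTail t (ratio k n) α C ≡ ρ ℚ.* ratio 1 n →
    ratio (s * k * T t) (M ^ t) ≡ ratio (s * k) n ℚ.* ρ
  tail-term ρ tail≡ρ/n = sym (begin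
    ratio (s * k) n ℚ.* ρ                       ≡⟨ cong (ℚ._* ρ) s*k/n ⟩
    (ratio (s * k) 1 ℚ.* ratio 1 n) ℚ.* ρ       ≡⟨ ℚP.*-assoc (ratio (s * k) 1) (ratio 1 n) ρ ⟩
    ratio (s * k) 1 ℚ.* (ratio 1 n ℚ.* ρ)       ≡⟨ cong (ratio (s * k) 1 ℚ.*_) (ℚP.*-comm (ratio 1 n) ρ) ⟩
    ratio (s * k) 1 ℚ.* (ρ ℚ.* ratio 1 n)       ≡⟨ cong (ratio (s * k) 1 ℚ.*_) tail-as-count ⟩
    ratio (s * k) 1 ℚ.* ratio (T t) (M ^ t)     ≡⟨ ratio-* {s * k} {1} {T t} {M ^ t} (s≤s z≤n) (1≤^ t M≥1) ⟩
    ratio (s * k * T t) (1 * M ^ t)             ≡⟨ cong (ratio (s * k * T t)) (*-identityˡ (M ^ t)) ⟩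
    ratio (s * k * T t) (M ^ t)                 ∎)
    where
    open ≡-Reasoning
    k/n≡a/M : ratio k n ≡ ratio a M
    k/n≡a/M = ratio-cong k n a M n≥1 M≥1 k*M≡a*n
    tail-as-count : ρ ℚ.* ratio 1 n ≡ ratio (T t) (M ^ t)
    tail-as-count = trans (sym tail≡ρ/n) (trans (cong (λ p → binomTail t p α C) k/n≡a/M) (tail≡ t α C))
    s*k/n : ratio (s * k) n ≡ ratio (s * k) 1 ℚ.* ratio 1 n
    s*k/n = sym (trans (ratio-* {s * k} {1} {1} {n} (s≤s z≤n) n≥1)
      (ratio-cong (s * k * 1) (1 * n) (s * k) n (1≤* {1} {n} (s≤s z≤n) n≥1) n≥1
        (cong₂ _*_ (*-identityʳ (s * k)) (sym (*-identityˡ n)))))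

  overloaded-term : ratio Σoverloaded (M ^ s) ℚ.≤ fromℕ n ℚ.* pow (ratio (s * k) n) (suc C)
  overloaded-term = subst (ratio Σoverloaded (M ^ s) ℚ.≤_) (sym rhs≡)
    (ratio-≤ Σoverloaded (M ^ s) (n * (s * k) ^ e) (1 * n ^ e) (1≤^ s M≥1)
             (1≤* {1} {n ^ e} (s≤s z≤n) (1≤^ e n≥1)) cleared)
    where
    e : ℕ
    e = suc C
    rhs≡ : fromℕ n ℚ.* pow (ratio (s * k) n) e ≡ ratio (n * (s * k) ^ e) (1 * n ^ e)
    rhs≡ = trans (cong (fromℕ n ℚ.*_) (ratio-pow {s * k} {n} e n≥1))
                 (ratio-* {n} {1} {(s * k) ^ e} {n ^ e} (s≤s z≤n) (1≤^ e n≥1))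
    -- Σoverloaded · n^e ≤ n (s k)^e M^s, from the union bound and k M = a n
    cleared : Σoverloaded * (1 * n ^ e) ≤ n * (s * k) ^ e * M ^ s
    cleared = *-cancelʳ-≤ (Σoverloaded * (1 * n ^ e)) (n * (s * k) ^ e * M ^ s) (M ^ e)
      {{>-nonZero (1≤^ e M≥1)}} (begin
      Σoverloaded * (1 * n ^ e) * M ^ e         ≡⟨ regroup₁ Σoverloaded (n ^ e) (M ^ e) ⟩
      Σoverloaded * M ^ e * n ^ e               ≤⟨ *-monoˡ-≤ (n ^ e) (Σ-overloaded s) ⟩
      n * (s ^ e * a ^ e * M ^ s) * n ^ e       ≡⟨ regroup₂ n (s ^ e) (a ^ e) (M ^ s) (n ^ e) ⟩
      n * s ^ e * (a ^ e * n ^ e) * M ^ s       ≡⟨ cong (λ z → n * s ^ e * z * M ^ s) (sym ([m*n]^e a n e)) ⟩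
      n * s ^ e * (a * n) ^ e * M ^ s           ≡⟨ cong (λ z → n * s ^ e * z ^ e * M ^ s) (sym k*M≡a*n) ⟩
      n * s ^ e * (k * M) ^ e * M ^ s           ≡⟨ cong (λ z → n * s ^ e * z * M ^ s) ([m*n]^e k M e) ⟩
      n * s ^ e * (k ^ e * M ^ e) * M ^ s       ≡⟨ regroup₃ n (s ^ e) (k ^ e) (M ^ e) (M ^ s) ⟩
      n * (s ^ e * k ^ e) * M ^ s * M ^ e       ≡⟨ cong (λ z → n * z * M ^ s * M ^ e) (sym ([m*n]^e s k e)) ⟩
      n * (s * k) ^ e * M ^ s * M ^ e           ∎)
      where
      open ≤-Reasoning
      regroup₁ : ∀ b ne me → b * (1 * ne) * me ≡ b * me * ne
      regroup₁ = solve-∀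
      regroup₂ : ∀ n se ae u ne → n * (se * ae * u) * ne ≡ n * se * (ae * ne) * u
      regroup₂ = solve-∀
      regroup₃ : ∀ n se ke me u → n * se * (ke * me) * u ≡ n * (se * ke) * u * me
      regroup₃ = solve-∀

  bound′ : (ρ : ℚ) → binomTail t (ratio k n) α C ≡ ρ ℚ.* ratio 1 n →
    ℚ.∣ PrΔ≤∣ n k m α S D ℚ.- PrΔ≤ n k m α ∣ ℚ.≤
      (ratio (s * k) n ℚ.* ρ ℚ.+ fromℕ n ℚ.* pow (ratio (s * k) n) (suc C))
  bound′ ρ tail≡ρ/n =
    ℚP.≤-trans distance≤ (ℚP.≤-trans (ℚP.≤-reflexive (ℚP.+-comm overloaded-part tail-part))
      (ℚP.+-mono-≤ (ℚP.≤-reflexive (tail-term ρ tail≡ρ/n)) overloaded-term))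
    where
    overloaded-part = ratio Σoverloaded (M ^ s)
    tail-part = ratio (s * k * T t) (M ^ t)

  bound : (ρ : ℚ) → binomTail (m ∸ ∣ S ∣) (ratio k n) α C ≡ ρ ℚ.* ratio 1 n →
    ℚ.∣ PrΔ≤∣ n k m α S D ℚ.- PrΔ≤ n k m α ∣ ℚ.≤
      (ratio (∣ S ∣ * k) n ℚ.* ρ ℚ.+ fromℕ n ℚ.* pow (ratio (∣ S ∣ * k) n) (suc C))
  bound ρ tail≡ρ/n =
    subst (λ x → ℚ.∣ PrΔ≤∣ n k m α S D ℚ.- PrΔ≤ n k m α ∣ ℚ.≤
                   (ratio (x * k) n ℚ.* ρ ℚ.+ fromℕ n ℚ.* pow (ratio (x * k) n) (suc C)))
          (card≡∣∣ S)
          (bound′ ρ (subst (λ x → binomTail x (ratio k n) α C ≡ ρ ℚ.* ratio 1 n) (sym (cocard≡ S)) tail≡ρ/n))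

open import Data.Nat using (suc; _≤_; _*_; _∸_)
open import Data.Rational using (_+_; _-_)
open import Data.Rational renaming (_*_ to _*ℚ_; _≤_ to _≤ℚ_) using ()
open import Data.Fin.Subset using (Subset)
open import Data.List using (length)
open import Data.List.Relation.Unary.All using (All)
open import Defs
open import Relation.Binary.PropositionalEquality using (refl; trans; sym)

-- Proposition 10.3: the bound of Conditioning for n = 1 + n' and s = |S|.
proposition10p3 : (n k m α C s : ℕ) → 1 ≤ n → k ≤ n → 1 ≤ α → 1 ≤ s → s ≤ m →
    (S : Subset m) → Data.Fin.Subset.∣ S ∣ ≡ s →
    (D : List (Subset n)) → length D ≡ s → All (λ A → Data.Fin.Subset.∣ A ∣ ≡ k) D →
    MaxDegreeAtMost C D →
    (ρ : ℚ) → binomTail (m ∸ s) (ratio k n) α C ≡ ρ *ℚ ratio 1 n →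
    Data.Rational.∣ PrΔ≤∣ n k m α S D - PrΔ≤ n k m α ∣
      ≤ℚ (ratio (s * k) n *ℚ ρ + fromℕ n *ℚ pow (ratio (s * k) n) (suc C))
proposition10p3 (suc n') k m α C _ _ k≤n _ _ _ S refl D |D| sizes Δ𝒟≤C ρ tail≡ρ/n =
  Conditioning.bound n' k k≤n α C m S D
    (trans |D| (sym (SplitAlongS.card≡∣∣ S))) sizes Δ𝒟≤C ρ tail≡ρ/n
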